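{- Let $1\le m\le n$ and $p\ge 2$ be integers, and suppose that neither ($m=2$ and $p\ge 5$) nor ($m=1$, $n\ge 2$ and $p\ge 4$) holds. Then any leaf decard together with any middle decard of the double-broom $D_{m,n,p}$ determines $D_{m,n,p}$.
   Context: All graphs are finite and simple. For integers $m,n\ge 1$, $p\ge 2$, the double-broom $D_{m,n,p}$ is the tree on $m+n+p$ vertices obtained from a path on $p$ vertices by attaching $m$ new leaf neighbours to one end of the path and $n$ new leaf neighbours to the other end. The degree $d(e)$ of an edge $e$ is the number of edges sharing an endpoint with $e$. A decard of $G$ is the pair $(G-e,d(e))$ with $G-e$ taken up to isomorphism; the dedeck of $G$ is the multiset of its decards over all edges $e$. A multiset $\mathcal S$ of decards of $G$ determines $G$ if every graph whose dedeck contains $\mathcal S$ as a sub-multiset is isomorphic to $G$. In $D_{m,n,p}$: a leaf edge is an edge incident to a leaf; a middle edge is an edge of degree $2$ not incident to a leaf. Leaf and middle decards are the decards obtained by deleting a leaf edge or a middle edge, respectively. -}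

module Defs where

open import Data.Nat using (ℕ; zero; suc; _+_; _∸_; _≤_; _<_; _≡ᵇ_; _<ᵇ_; _≤ᵇ_)
open import Data.Bool using (Bool; true; false; _∧_; _∨_; not; if_then_else_)
open import Data.Fin using (Fin; toℕ)
open import Data.List using (List; []; _∷_; length; lookup; filter; concatMap; map)
open import Data.Nat.ListAction using (sum)
open import Data.List.Base using (allFin)
open import Data.Product using (Σ; _×_; _,_; ∃)
open import Relation.Binary.PropositionalEquality using (_≡_)
open import Relation.Nullary using (¬_)
open import Function.Bundles using (_↔_; Inverse)

record Graph : Set where
  constructor mkGraph
  field
    order : ℕ
    adj   : Fin order → Fin order → Bool
open Graph public

SimpleGraph : Graph → Set
SimpleGraph G = (∀ x y → adj G x y ≡ adj G y x) × (∀ x → adj G x x ≡ false)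

_≅_ : Graph → Graph → Set
G ≅ H = Σ (Fin (order G) ↔ Fin (order H)) λ f →
          ∀ x y → adj G x y ≡ adj H (Inverse.to f x) (Inverse.to f y)

_==_ : ∀ {k} → Fin k → Fin k → Bool
x == y = toℕ x ≡ᵇ toℕ y

-- An edge {u,v} of G, stored with toℕ u < toℕ v (so each edge is represented once).
record Edge (G : Graph) : Set where
  constructor mkEdge
  field
    u v  : Fin (order G)
    u<v  : toℕ u < toℕ v
    isAdj : adj G u v ≡ true
open Edge public

SameEdge : ∀ {G} → Edge G → Edge G → Set
SameEdge e f = (u e ≡ u f) × (v e ≡ v f)

samePair : ∀ {k} → Fin k → Fin k → Fin k → Fin k → Bool
samePair a b x y = (x == a ∧ y == b) ∨ (x == b ∧ y == a)

pairs : (k : ℕ) → List (Fin k × Fin k)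
pairs k = filter (λ { (x , y) → toℕ x Data.Nat.<? toℕ y })
                 (concatMap (λ x → map (x ,_) (allFin k)) (allFin k))

count : ∀ {A : Set} → (A → Bool) → List A → ℕ
count P xs = sum (map (λ a → if P a then 1 else 0) xs)

vdeg : (G : Graph) → Fin (order G) → ℕ
vdeg G x = count (adj G x) (allFin (order G))

edeg : (G : Graph) → Edge G → ℕ
edeg G e = count (λ { (x , y) → adj G x y ∧ not (samePair (u e) (v e) x y)
                                ∧ (x == u e ∨ x == v e ∨ y == u e ∨ y == v e) })
                 (pairs (order G))

deleteEdge : (G : Graph) → Edge G → Graph
deleteEdge G e = mkGraph (order G) (λ x y → adj G x y ∧ not (samePair (u e) (v e) x y))

Decard : Set
Decard = Graph × ℕ

decard : (G : Graph) → Edge G → Decard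
decard G e = deleteEdge G e , edeg G e

_≈D_ : Decard → Decard → Set
(G , a) ≈D (H , b) = (G ≅ H) × (a ≡ b)

-- The dedeck of H contains the multiset S (given as a list) as a sub-multiset:
-- an injective assignment of edges of H to the entries of S with matching decards.
DedeckContains : (H : Graph) → List Decard → Set
DedeckContains H S =
  Σ (Fin (length S) → Edge H) λ f →
    (∀ i j → SameEdge (f i) (f j) → i ≡ j) ×
    (∀ i → lookup S i ≈D decard H (f i))

Determines : Graph → List Decard → Set
Determines G S = (H : Graph) → SimpleGraph H → DedeckContains H S → H ≅ G

-- Double broom D_{m,n,p} on vertices 0..p+m+n-1:
-- path 0 - 1 - ... - (p-1); leaves p..p+m-1 attached to 0; leaves p+m..p+m+n-1 attached to p-1.
broomAdjℕ : ℕ → ℕ → ℕ → ℕ → ℕ → Bool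
broomAdjℕ m n p a b = path ∨ leafL a b ∨ leafL b a ∨ leafR a b ∨ leafR b a
  where
    path = (a <ᵇ p) ∧ (b <ᵇ p) ∧ ((suc a ≡ᵇ b) ∨ (suc b ≡ᵇ a))
    leafL : ℕ → ℕ → Bool
    leafL x y = (x ≡ᵇ 0) ∧ (p ≤ᵇ y) ∧ (y <ᵇ p + m)
    leafR : ℕ → ℕ → Bool
    leafR x y = (x ≡ᵇ p ∸ 1) ∧ (p + m ≤ᵇ y) ∧ (y <ᵇ p + m + n)

DoubleBroom : ℕ → ℕ → ℕ → Graph
DoubleBroom m n p = mkGraph (p + m + n) (λ x y → broomAdjℕ m n p (toℕ x) (toℕ y))

LeafEdge : (G : Graph) → Edge G → Set
LeafEdge G e = (vdeg G (u e) ≡ 1) Data.Sum.⊎ (vdeg G (v e) ≡ 1)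
  where import Data.Sum

MiddleEdge : (G : Graph) → Edge G → Set
MiddleEdge G e = (edeg G e ≡ 2) × ¬ (vdeg G (u e) ≡ 1) × ¬ (vdeg G (v e) ≡ 1)

-- Let H have both decards and let cℓ be the leaf edge, ℓ the leaf.  Adding back to G - cℓ the edge of H
-- deleted in the leaf decard gives a copy of H.  Since ℓ is isolated in G - cℓ, whereas deleting a middle
-- edge leaves no isolated vertex, that edge is ℓx for some vertex x, and the equality of edge degrees gives
-- deg x = deg c - 1 unless x = c.  Going through the possible positions of x on the broom, either the graph
-- obtained is again isomorphic to G (x = c; m = n = 1, where G is a path; n = m + 1 and x the other centre),
-- or the edge of H corresponding to the middle decard would join two vertices of degree 2 that are not
-- adjacent in G, or deleting it would leave an isolated edge, which G minus a middle edge never has.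

module Submission where

open import Defs
open import Data.Nat using (ℕ; zero; suc; _+_; _∸_; _≤_; _<_; _≡ᵇ_; _<ᵇ_; _≤ᵇ_; _<?_; _≟_; z≤n; s≤s; ⌊_/2⌋)
open import Data.Nat.Properties
import Data.Nat.ListAction as List
open import Data.Bool using (Bool; true; false; _∧_; _∨_; not; if_then_else_; T)
open import Data.Bool.Properties
  using (∧-comm; ∨-comm; ∧-assoc; ∨-assoc; ∧-zeroʳ; ∧-identityʳ; ∨-zeroʳ; ∨-identityʳ; ∧-distribˡ-∨; T-∧; T-∨; T-≡)
open import Data.Fin using (Fin; toℕ; zero; suc; fromℕ<)
open import Data.Fin.Properties using (toℕ-injective; toℕ<n; toℕ-fromℕ<) renaming (_≟_ to _≟ᶠ_)
open import Data.List using (List; []; _∷_; filter; concatMap; map; _++_; tabulate; allFin)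
import Data.Product
open import Data.Product using (Σ; _×_; _,_; proj₁; proj₂)
import Data.Sum
open import Data.Sum using (_⊎_; inj₁; inj₂; [_,_]; swap)
open import Data.Empty using (⊥; ⊥-elim)
open import Data.Unit using (tt)
open import Relation.Binary.PropositionalEquality hiding ([_])
open import Relation.Binary.Definitions using (tri<; tri≈; tri>)
open import Relation.Nullary using (¬_; Dec; does; yes; no)
open import Relation.Nullary.Decidable using (dec-true; dec-false)
open import Function using (_∘_; id; case_of_; _↔_; Inverse; mk↔ₛ′; Equivalence)
open import Function.Construct.Identity using (↔-id)
open import Function.Construct.Symmetry using (↔-sym)
open import Function.Construct.Composition using (_↔-∘_)
open import Algebra.Properties.CommutativeMonoid.Sum +-0-commutativeMonoid
  using (sum; sum-permute; ∑-comm; ∑-distrib-+; sum-cong-≗; sum-replicate-zero)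

indicator : Bool → ℕ
indicator b = if b then 1 else 0

∧≡true : ∀ {x y} → (x ∧ y) ≡ true → x ≡ true × y ≡ true
∧≡true {true} {true} refl = refl , refl

≡ᵇ-refl : ∀ a → (a ≡ᵇ a) ≡ true
≡ᵇ-refl a = Equivalence.to T-≡ (≡⇒≡ᵇ a a refl)

≡ᵇ-false : ∀ {a b} → ¬ a ≡ b → (a ≡ᵇ b) ≡ false
≡ᵇ-false {a} {b} a≢b = dec-false (a ≟ b) a≢b

<ᵇ-true : ∀ {a b} → a < b → (a <ᵇ b) ≡ true
<ᵇ-true = Equivalence.to T-≡ ∘ <⇒<ᵇ

<ᵇ-false : ∀ {a b} → ¬ a < b → (a <ᵇ b) ≡ false
<ᵇ-false {a} {b} a≮b with a <ᵇ b in a<ᵇb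
... | false = refl
... | true = ⊥-elim (a≮b (<ᵇ⇒< a b (Equivalence.from T-≡ a<ᵇb)))

≤ᵇ-true : ∀ {a b} → a ≤ b → (a ≤ᵇ b) ≡ true
≤ᵇ-true = Equivalence.to T-≡ ∘ ≤⇒≤ᵇ

∸-suc : ∀ {m n} → n < m → suc (m ∸ suc n) ≡ m ∸ n
∸-suc {m} n<m = sym (+-∸-assoc 1 n<m)

+-double-injective : ∀ m n → m + m ≡ n + n → m ≡ n
+-double-injective m n h = trans (n≡⌊n+n/2⌋ m) (trans (cong ⌊_/2⌋ h) (sym (n≡⌊n+n/2⌋ n)))

both-two : ∀ {x y} → x + y ≡ 4 → 2 ≤ x → 2 ≤ y → x ≡ 2 × y ≡ 2
both-two {x} {y} x+y≡4 2≤x 2≤y =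
  ≤-antisym (+-cancelʳ-≤ y x 2 (subst (_≤ 2 + y) (sym x+y≡4) (+-monoʳ-≤ 2 2≤y))) 2≤x ,
  ≤-antisym (+-cancelˡ-≤ x y 2 (subst (_≤ x + 2) (sym x+y≡4) (+-monoˡ-≤ 2 2≤x))) 2≤y

==-refl : ∀ {k} (x : Fin k) → (x == x) ≡ true
==-refl x = dec-true (toℕ x ≟ toℕ x) refl

≢⇒==-false : ∀ {k} {x y : Fin k} → ¬ x ≡ y → (x == y) ≡ false
≢⇒==-false {x = x} {y} x≢y = dec-false (toℕ x ≟ toℕ y) (x≢y ∘ toℕ-injective)

==⇒≡ : ∀ {k} (x y : Fin k) → (x == y) ≡ true → x ≡ y
==⇒≡ x y h = toℕ-injective (≡ᵇ⇒≡ (toℕ x) (toℕ y) (subst T (sym h) tt))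

samePair-comm : ∀ {k} (a b x y : Fin k) → samePair a b x y ≡ samePair b a x y
samePair-comm a b x y = ∨-comm (x == a ∧ y == b) (x == b ∧ y == a)

samePair-flip : ∀ {k} (a b x y : Fin k) → samePair a b x y ≡ samePair a b y x
samePair-flip a b x y =
  trans (∨-comm (x == a ∧ y == b) (x == b ∧ y == a)) (cong₂ _∨_ (∧-comm (x == b) (y == a)) (∧-comm (x == a) (y == b)))

samePair-self : ∀ {k} (a b : Fin k) → samePair a b a b ≡ true
samePair-self a b rewrite ==-refl a | ==-refl b = refl

samePair-endpoint : ∀ {k} {a b : Fin k} → ¬ a ≡ b → ∀ y → samePair a b a y ≡ (y == b)
samePair-endpoint {a = a} {b} a≢b y rewrite ==-refl a | ≢⇒==-false a≢b = ∨-identityʳ (y == b)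

samePair-outside : ∀ {k} {a b w : Fin k} → ¬ w ≡ a → ¬ w ≡ b → ∀ y → samePair a b w y ≡ false
samePair-outside w≢a w≢b y rewrite ≢⇒==-false w≢a | ≢⇒==-false w≢b = refl

samePair-outsideʳ : ∀ {k} {a b y : Fin k} → ¬ y ≡ a → ¬ y ≡ b → ∀ w → samePair a b w y ≡ false
samePair-outsideʳ {a = a} {b} {y} y≢a y≢b w = trans (samePair-flip a b w y) (samePair-outside y≢a y≢b w)

samePair⇒ : ∀ {k} (a b x y : Fin k) → samePair a b x y ≡ true → (x ≡ a × y ≡ b) ⊎ (x ≡ b × y ≡ a)
samePair⇒ a b x y h with x == a in xa | y == b in yb
... | true | true = inj₁ (==⇒≡ x a xa , ==⇒≡ y b yb)
... | true | false with x == b in xb | y == a in ya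
...   | true | true = inj₂ (==⇒≡ x b xb , ==⇒≡ y a ya)
samePair⇒ a b x y h | false | _ with x == b in xb | y == a in ya
...   | true | true = inj₂ (==⇒≡ x b xb , ==⇒≡ y a ya)

PairOf : ℕ → ℕ → ℕ → ℕ → Set
PairOf a b s t = (s ≡ a × t ≡ b) ⊎ (s ≡ b × t ≡ a)

PairOf-swap : ∀ {a b s t} → PairOf a b s t → PairOf a b t s
PairOf-swap = swap ∘ Data.Sum.map swap′ swap′
  where swap′ = Data.Product.swap

samePair-sound : ∀ {k} (a b s t : Fin k) → samePair a b s t ≡ true → PairOf (toℕ a) (toℕ b) (toℕ s) (toℕ t)
samePair-sound a b s t same with samePair⇒ a b s t same
... | inj₁ (refl , refl) = inj₁ (refl , refl)
... | inj₂ (refl , refl) = inj₂ (refl , refl)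

samePair-complete : ∀ {k} (a b s t : Fin k) → PairOf (toℕ a) (toℕ b) (toℕ s) (toℕ t) → samePair a b s t ≡ true
samePair-complete a b s t (inj₁ (s≡a , t≡b)) with toℕ-injective s≡a | toℕ-injective t≡b
... | refl | refl = samePair-self a b
samePair-complete a b s t (inj₂ (s≡b , t≡a)) with toℕ-injective s≡b | toℕ-injective t≡a
... | refl | refl = trans (samePair-flip a b b a) (samePair-self a b)

countFin : ∀ {k} → (Fin k → Bool) → ℕ
countFin P = sum (indicator ∘ P)

count-tabulate : ∀ {A : Set} {k} (P : A → Bool) (f : Fin k → A) →
                 count P (tabulate f) ≡ countFin (P ∘ f)
count-tabulate {k = zero}  P f = refl
count-tabulate {k = suc k} P f = cong (indicator (P (f zero)) +_) (count-tabulate P (f ∘ suc))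

vdeg≡countFin : (G : Graph) (x : Fin (order G)) → vdeg G x ≡ countFin (adj G x)
vdeg≡countFin G x = count-tabulate (adj G x) id

countFin-cong : ∀ {k} {P Q : Fin k → Bool} → (∀ i → P i ≡ Q i) → countFin P ≡ countFin Q
countFin-cong P≗Q = sum-cong-≗ (cong indicator ∘ P≗Q)

countFin-permute : ∀ {k k′} (π : Fin k ↔ Fin k′) (P : Fin k′ → Bool) →
                   countFin P ≡ countFin (P ∘ Inverse.to π)
countFin-permute π P = sum-permute (indicator ∘ P) π

countFin-false : ∀ {k} {P : Fin k → Bool} → (∀ i → P i ≡ false) → countFin P ≡ 0
countFin-false {k} P≡false = trans (countFin-cong P≡false) (sum-replicate-zero k)

countFin≡0 : ∀ {k} (P : Fin k → Bool) → countFin P ≡ 0 → ∀ i → P i ≡ false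
countFin≡0 P h zero with P zero
... | false = refl
countFin≡0 P h (suc i) with P zero
... | false = countFin≡0 (P ∘ suc) h i

sum-ifEq : ∀ {k} (v : Fin k) (d : Fin k → ℕ) → sum (λ x → if x == v then d x else 0) ≡ d v
sum-ifEq {suc k} zero    d = trans (cong (d zero +_) (sum-replicate-zero k)) (+-identityʳ _)
sum-ifEq {suc k} (suc v) d = sum-ifEq v (d ∘ suc)

countFin-∧-== : ∀ {k} (P : Fin k → Bool) (v : Fin k) → countFin (λ y → P y ∧ (y == v)) ≡ indicator (P v)
countFin-∧-== P v = trans (sum-cong-≗ (λ y → indicator-∧ (P y) (y == v))) (sum-ifEq v (indicator ∘ P))
  where
  indicator-∧ : ∀ a b → indicator (a ∧ b) ≡ (if b then indicator a else 0)
  indicator-∧ a true  = cong indicator (∧-identityʳ a)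
  indicator-∧ a false = cong indicator (∧-zeroʳ a)

countFin-split : ∀ {k} (P Q : Fin k → Bool) →
                 countFin P ≡ countFin (λ y → P y ∧ not (Q y)) + countFin (λ y → P y ∧ Q y)
countFin-split P Q = trans (sum-cong-≗ (λ y → split (P y) (Q y)))
  (∑-distrib-+ (λ y → indicator (P y ∧ not (Q y))) (λ y → indicator (P y ∧ Q y)))
  where
  split : ∀ a b → indicator a ≡ indicator (a ∧ not b) + indicator (a ∧ b)
  split false b     = refl
  split true  false = refl
  split true  true  = refl

countFin-∨ : ∀ {k} (P Q : Fin k → Bool) → (∀ y → (P y ∧ Q y) ≡ false) →
             countFin (λ y → P y ∨ Q y) ≡ countFin P + countFin Q
countFin-∨ P Q disjoint = trans (sum-cong-≗ (λ y → split (P y) (Q y) (disjoint y)))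
  (∑-distrib-+ (indicator ∘ P) (indicator ∘ Q))
  where
  split : ∀ a b → (a ∧ b) ≡ false → indicator (a ∨ b) ≡ indicator a + indicator b
  split false b     _ = refl
  split true  false _ = refl

sum-if-∨ : ∀ {k} (a b : Fin k) → ¬ a ≡ b → (d : Fin k → ℕ) →
           sum (λ x → if x == a ∨ x == b then d x else 0) ≡ d a + d b
sum-if-∨ a b a≢b d = begin
  sum (λ x → if x == a ∨ x == b then d x else 0)
    ≡⟨ sum-cong-≗ split ⟩
  sum (λ x → (if x == a then d x else 0) + (if x == b then d x else 0))
    ≡⟨ ∑-distrib-+ (λ x → if x == a then d x else 0) (λ x → if x == b then d x else 0) ⟩
  sum (λ x → if x == a then d x else 0) + sum (λ x → if x == b then d x else 0)
    ≡⟨ cong₂ _+_ (sum-ifEq a d) (sum-ifEq b d) ⟩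
  d a + d b ∎
  where
  open ≡-Reasoning
  split : ∀ x → (if x == a ∨ x == b then d x else 0) ≡ (if x == a then d x else 0) + (if x == b then d x else 0)
  split x with x == a in xa | x == b in xb
  ... | true  | true  = ⊥-elim (a≢b (trans (sym (==⇒≡ x a xa)) (==⇒≡ x b xb)))
  ... | true  | false = sym (+-identityʳ (d x))
  ... | false | true  = refl
  ... | false | false = refl

_<ᶠᵇ_ : ∀ {k} → Fin k → Fin k → Bool
x <ᶠᵇ y = does (toℕ x <? toℕ y)

countUpper : ∀ {k} → (Fin k → Fin k → Bool) → ℕ
countUpper R = sum (λ x → countFin (λ y → (x <ᶠᵇ y) ∧ R x y))

count-++ : ∀ {A : Set} (P : A → Bool) xs ys → count P (xs ++ ys) ≡ count P xs + count P ys
count-++ P []       ys = refl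
count-++ P (x ∷ xs) ys = trans (cong (indicator (P x) +_) (count-++ P xs ys)) (sym (+-assoc (indicator (P x)) _ _))

count-filter : ∀ {A : Set} {Pr : A → Set} (P : A → Bool) (Pr? : ∀ a → Dec (Pr a)) xs →
               count P (filter Pr? xs) ≡ count (λ a → does (Pr? a) ∧ P a) xs
count-filter P Pr? []       = refl
count-filter P Pr? (x ∷ xs) with does (Pr? x)
... | true  = cong (indicator (P x) +_) (count-filter P Pr? xs)
... | false = count-filter P Pr? xs

count-map : ∀ {A B : Set} (P : B → Bool) (f : A → B) xs → count P (map f xs) ≡ count (P ∘ f) xs
count-map P f []       = refl
count-map P f (x ∷ xs) = cong (indicator (P (f x)) +_) (count-map P f xs)

count-concatMap : ∀ {A B : Set} (P : B → Bool) (f : A → List B) xs →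
                  count P (concatMap f xs) ≡ List.sum (map (count P ∘ f) xs)
count-concatMap P f []       = refl
count-concatMap P f (x ∷ xs) =
  trans (count-++ P (f x) (concatMap f xs)) (cong (count P (f x) +_) (count-concatMap P f xs))

sum-map-tabulate : ∀ {A : Set} {k} (h : A → ℕ) (f : Fin k → A) →
                   List.sum (map h (tabulate f)) ≡ sum (h ∘ f)
sum-map-tabulate {k = zero}  h f = refl
sum-map-tabulate {k = suc k} h f = cong (h (f zero) +_) (sum-map-tabulate h (f ∘ suc))

count-pairs : ∀ k (P : Fin k × Fin k → Bool) → count P (pairs k) ≡ countUpper (λ x y → P (x , y))
count-pairs k P = begin
  count P (pairs k)
    ≡⟨ count-filter P _ (concatMap row (allFin k)) ⟩
  count Q (concatMap row (allFin k))
    ≡⟨ count-concatMap Q row (allFin k) ⟩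
  List.sum (map (count Q ∘ row) (allFin k))
    ≡⟨ sum-map-tabulate (count Q ∘ row) id ⟩
  sum (count Q ∘ row)
    ≡⟨ sum-cong-≗ (λ x → trans (count-map Q (x ,_) (allFin k)) (count-tabulate (Q ∘ (x ,_)) id)) ⟩
  countUpper (λ x y → P (x , y)) ∎
  where
  open ≡-Reasoning
  row : Fin k → List (Fin k × Fin k)
  row x = map (x ,_) (allFin k)
  Q : Fin k × Fin k → Bool
  Q (x , y) = (x <ᶠᵇ y) ∧ P (x , y)

countUpper-double : ∀ {k} (R : Fin k → Fin k → Bool) → (∀ x y → R x y ≡ R y x) → (∀ x → R x x ≡ false) →
                    countUpper R + countUpper R ≡ sum (λ x → countFin (R x))
countUpper-double R R-sym R-irr = sym (begin
  sum (λ x → countFin (R x))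
    ≡⟨ sum-cong-≗ (λ x → trans (sum-cong-≗ (λ y → upper+lower x y)) (∑-distrib-+ (upper x) (lower x))) ⟩
  sum (λ x → countFin (λ y → (x <ᶠᵇ y) ∧ R x y) + sum (lower x))
    ≡⟨ ∑-distrib-+ (λ x → countFin (λ y → (x <ᶠᵇ y) ∧ R x y)) (λ x → sum (lower x)) ⟩
  countUpper R + sum (λ x → sum (lower x))
    ≡⟨ cong (countUpper R +_) (∑-comm lower) ⟩
  countUpper R + countUpper R ∎)
  where
  open ≡-Reasoning
  upper lower : _ → _ → ℕ
  upper x y = indicator ((x <ᶠᵇ y) ∧ R x y)
  lower x y = indicator ((y <ᶠᵇ x) ∧ R y x)
  upper+lower : ∀ x y → indicator (R x y) ≡ upper x y + lower x y
  upper+lower x y with <-cmp (toℕ x) (toℕ y)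
  ... | tri< x<y _ y≮x rewrite dec-true (toℕ x <? toℕ y) x<y | dec-false (toℕ y <? toℕ x) y≮x =
        sym (+-identityʳ _)
  ... | tri> x≮y _ y<x rewrite dec-false (toℕ x <? toℕ y) x≮y | dec-true (toℕ y <? toℕ x) y<x =
        cong indicator (R-sym x y)
  ... | tri≈ _ x≡y _ with toℕ-injective x≡y
  ...   | refl rewrite R-irr x | ∧-zeroʳ (x <ᶠᵇ x) = refl

countBelow : (ℕ → Bool) → ℕ → ℕ
countBelow f zero    = 0
countBelow f (suc k) = countBelow f k + indicator (f k)

countFin-toℕ : ∀ k (f : ℕ → Bool) → countFin {k} (f ∘ toℕ) ≡ countBelow f k
countFin-toℕ zero    f = refl
countFin-toℕ (suc k) f = trans (cong (indicator (f 0) +_) (countFin-toℕ k (f ∘ suc))) (shift f k)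
  where
  shift : ∀ f k → indicator (f 0) + countBelow (f ∘ suc) k ≡ countBelow f (suc k)
  shift f zero    = +-comm (indicator (f 0)) 0
  shift f (suc k) = trans (sym (+-assoc (indicator (f 0)) _ _)) (cong (_+ indicator (f (suc k))) (shift f k))

countBelow-false : ∀ f {a} k → a ≤ k → (∀ b → a ≤ b → b < k → f b ≡ false) → countBelow f k ≡ countBelow f a
countBelow-false f zero    z≤n  _     = refl
countBelow-false f {a} (suc k) a≤1+k off with m≤n⇒m<n∨m≡n a≤1+k
... | inj₂ refl = refl
... | inj₁ a<1+k = begin
  countBelow f k + indicator (f k) ≡⟨ cong (countBelow f k +_) (cong indicator (off k a≤k (n<1+n k))) ⟩
  countBelow f k + 0               ≡⟨ +-identityʳ _ ⟩
  countBelow f k                   ≡⟨ countBelow-false f k a≤k (λ b a≤b b<k → off b a≤b (m<n⇒m<1+n b<k)) ⟩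
  countBelow f a ∎
  where
  open ≡-Reasoning
  a≤k = ≤-pred a<1+k

countBelow-true : ∀ f a d → (∀ b → a ≤ b → b < a + d → f b ≡ true) → countBelow f (a + d) ≡ countBelow f a + d
countBelow-true f a zero    _    = trans (cong (countBelow f) (+-identityʳ a)) (sym (+-identityʳ _))
countBelow-true f a (suc d) on = begin
  countBelow f (a + suc d)              ≡⟨ cong (countBelow f) (+-suc a d) ⟩
  countBelow f (a + d) + indicator (f (a + d))
    ≡⟨ cong₂ _+_ (countBelow-true f a d (λ b a≤b b<a+d → on b a≤b (<-trans b<a+d a+d<a+1+d)))
                 (cong indicator (on (a + d) (m≤m+n a d) a+d<a+1+d)) ⟩
  countBelow f a + d + 1                ≡⟨ +-assoc (countBelow f a) d 1 ⟩
  countBelow f a + (d + 1)              ≡⟨ cong (countBelow f a +_) (+-comm d 1) ⟩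
  countBelow f a + suc d ∎
  where
  open ≡-Reasoning
  a+d<a+1+d = +-monoʳ-< a (n<1+n d)

addPair : (X : Graph) → Fin (order X) → Fin (order X) → Graph
addPair X a b = mkGraph (order X) (λ x y → adj X x y ∨ samePair a b x y)

deletePair : (X : Graph) → Fin (order X) → Fin (order X) → Graph
deletePair X a b = mkGraph (order X) (λ x y → adj X x y ∧ not (samePair a b x y))

edge≢ : ∀ {G} (e : Edge G) → ¬ u e ≡ v e
edge≢ e u≡v = <-irrefl (cong toℕ u≡v) (u<v e)

Symmetric : Graph → Set
Symmetric X = ∀ x y → adj X x y ≡ adj X y x

deletePair-symmetric : (X : Graph) (a b : Fin (order X)) → Symmetric X → Symmetric (deletePair X a b)
deletePair-symmetric X a b X-sym x y = cong₂ _∧_ (X-sym x y) (cong not (samePair-flip a b x y))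

addPair-symmetric : (X : Graph) (a b : Fin (order X)) → Symmetric X → Symmetric (addPair X a b)
addPair-symmetric X a b X-sym x y = cong₂ _∨_ (X-sym x y) (samePair-flip a b x y)

vdeg-deletePair-endpoint : (X : Graph) {a b : Fin (order X)} → ¬ a ≡ b → adj X a b ≡ true →
                           vdeg X a ≡ suc (vdeg (deletePair X a b) a)
vdeg-deletePair-endpoint X {a} {b} a≢b ab = begin
  vdeg X a
    ≡⟨ vdeg≡countFin X a ⟩
  countFin (adj X a)
    ≡⟨ countFin-split (adj X a) (_== b) ⟩
  countFin (λ y → adj X a y ∧ not (y == b)) + countFin (λ y → adj X a y ∧ (y == b))
    ≡⟨ cong₂ _+_ (countFin-cong (λ y → cong (λ t → adj X a y ∧ not t) (sym (samePair-endpoint a≢b y))))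
                 (trans (countFin-∧-== (adj X a) b) (cong indicator ab)) ⟩
  countFin (adj (deletePair X a b) a) + 1
    ≡⟨ +-comm _ 1 ⟩
  suc (countFin (adj (deletePair X a b) a))
    ≡⟨ cong suc (vdeg≡countFin (deletePair X a b) a) ⟨
  suc (vdeg (deletePair X a b) a) ∎
  where open ≡-Reasoning

vdeg-deletePair-comm : (X : Graph) (a b w : Fin (order X)) → vdeg (deletePair X a b) w ≡ vdeg (deletePair X b a) w
vdeg-deletePair-comm X a b w = trans (vdeg≡countFin (deletePair X a b) w) (trans
  (countFin-cong (λ y → cong (λ t → adj X w y ∧ not t) (samePair-comm a b w y)))
  (sym (vdeg≡countFin (deletePair X b a) w)))

vdeg-deletePair-other : (X : Graph) {a b w : Fin (order X)} → ¬ w ≡ a → ¬ w ≡ b →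
                        vdeg (deletePair X a b) w ≡ vdeg X w
vdeg-deletePair-other X {a} {b} {w} w≢a w≢b = trans (vdeg≡countFin (deletePair X a b) w) (trans
  (countFin-cong (λ y → trans (cong (λ t → adj X w y ∧ not t) (samePair-outside w≢a w≢b y)) (∧-identityʳ _)))
  (sym (vdeg≡countFin X w)))

vdeg-deletePair-≤ : (X : Graph) (a b w : Fin (order X)) → vdeg (deletePair X a b) w ≤ vdeg X w
vdeg-deletePair-≤ X a b w = begin
  vdeg (deletePair X a b) w    ≡⟨ vdeg≡countFin (deletePair X a b) w ⟩
  countFin (λ y → adj X w y ∧ not (samePair a b w y))
                               ≤⟨ m≤m+n _ _ ⟩
  countFin (λ y → adj X w y ∧ not (samePair a b w y)) + countFin (λ y → adj X w y ∧ samePair a b w y)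
                               ≡⟨ countFin-split (adj X w) (samePair a b w) ⟨
  countFin (adj X w)           ≡⟨ vdeg≡countFin X w ⟨
  vdeg X w ∎
  where open ≤-Reasoning

vdeg-addPair-endpoint : (X : Graph) {a b : Fin (order X)} → ¬ a ≡ b → adj X a b ≡ false →
                        vdeg (addPair X a b) a ≡ suc (vdeg X a)
vdeg-addPair-endpoint X {a} {b} a≢b ab = begin
  vdeg (addPair X a b) a
    ≡⟨ vdeg≡countFin (addPair X a b) a ⟩
  countFin (λ y → adj X a y ∨ samePair a b a y)
    ≡⟨ countFin-cong (λ y → cong (adj X a y ∨_) (samePair-endpoint a≢b y)) ⟩
  countFin (λ y → adj X a y ∨ (y == b))
    ≡⟨ countFin-∨ (adj X a) (_== b) disjoint ⟩
  countFin (adj X a) + countFin (_== b)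
    ≡⟨ cong (countFin (adj X a) +_) (trans (countFin-∧-== (λ _ → true) b) refl) ⟩
  countFin (adj X a) + 1
    ≡⟨ +-comm _ 1 ⟩
  suc (countFin (adj X a))
    ≡⟨ cong suc (vdeg≡countFin X a) ⟨
  suc (vdeg X a) ∎
  where
  open ≡-Reasoning
  disjoint : ∀ y → (adj X a y ∧ (y == b)) ≡ false
  disjoint y with y == b in yb
  ... | false = ∧-zeroʳ (adj X a y)
  ... | true = trans (∧-identityʳ _) (subst (λ z → adj X a z ≡ false) (sym (==⇒≡ y b yb)) ab)

vdeg-addPair-comm : (X : Graph) (a b w : Fin (order X)) → vdeg (addPair X a b) w ≡ vdeg (addPair X b a) w
vdeg-addPair-comm X a b w = trans (vdeg≡countFin (addPair X a b) w) (trans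
  (countFin-cong (λ y → cong (adj X w y ∨_) (samePair-comm a b w y)))
  (sym (vdeg≡countFin (addPair X b a) w)))

vdeg-addPair-other : (X : Graph) {a b w : Fin (order X)} → ¬ w ≡ a → ¬ w ≡ b →
                     vdeg (addPair X a b) w ≡ vdeg X w
vdeg-addPair-other X {a} {b} {w} w≢a w≢b = trans (vdeg≡countFin (addPair X a b) w) (trans
  (countFin-cong (λ y → trans (cong (adj X w y ∨_) (samePair-outside w≢a w≢b y)) (∨-identityʳ _)))
  (sym (vdeg≡countFin X w)))

module _ {k k′ : ℕ} (σ : Fin k ↔ Fin k′) where
  private
    to = Inverse.to σ
    from = Inverse.from σ

  to-from : ∀ y → to (from y) ≡ y
  to-from = Inverse.strictlyInverseˡ σ

  from-to : ∀ x → from (to x) ≡ x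
  from-to = Inverse.strictlyInverseʳ σ

  ==-to : ∀ x y → (to x == to y) ≡ (x == y)
  ==-to x y with x ≟ᶠ y
  ... | yes refl = trans (==-refl (to x)) (sym (==-refl x))
  ... | no x≢y = trans (≢⇒==-false (λ tx≡ty → x≢y (trans (sym (from-to x)) (trans (cong from tx≡ty) (from-to y))))) (sym (≢⇒==-false x≢y))

  samePair-to : ∀ a b x y → samePair (to a) (to b) (to x) (to y) ≡ samePair a b x y
  samePair-to a b x y rewrite ==-to x a | ==-to y b | ==-to x b | ==-to y a = refl

≅-sym : ∀ {X Y : Graph} → X ≅ Y → Y ≅ X
≅-sym {X} {Y} (σ , pres) = ↔-sym σ , λ x y →
  sym (trans (pres (Inverse.from σ x) (Inverse.from σ y)) (cong₂ (adj Y) (to-from σ x) (to-from σ y)))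

≅-trans : ∀ {X Y Z : Graph} → X ≅ Y → Y ≅ Z → X ≅ Z
≅-trans (σ , p) (τ , q) = τ ↔-∘ σ , λ x y → trans (p x y) (q _ _)

≅-pointwise : ∀ {k} {A B : Fin k → Fin k → Bool} → (∀ x y → A x y ≡ B x y) → mkGraph k A ≅ mkGraph k B
≅-pointwise A≗B = ↔-id _ , A≗B

vdeg-≅ : {X Y : Graph} (φ : X ≅ Y) (x : Fin (order X)) → vdeg Y (Inverse.to (proj₁ φ) x) ≡ vdeg X x
vdeg-≅ {X} {Y} (σ , pres) x = begin
  vdeg Y (to x)                     ≡⟨ vdeg≡countFin Y (to x) ⟩
  countFin (adj Y (to x))           ≡⟨ countFin-permute σ (adj Y (to x)) ⟩
  countFin (adj Y (to x) ∘ to)      ≡⟨ countFin-cong (sym ∘ pres x) ⟩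
  countFin (adj X x)                ≡⟨ vdeg≡countFin X x ⟨
  vdeg X x ∎
  where
  open ≡-Reasoning
  to = Inverse.to σ

deletePair-≅ : {X Y : Graph} (φ : X ≅ Y) (a b : Fin (order X)) →
               deletePair X a b ≅ deletePair Y (Inverse.to (proj₁ φ) a) (Inverse.to (proj₁ φ) b)
deletePair-≅ (σ , pres) a b = σ , λ x y → cong₂ _∧_ (pres x y) (cong not (sym (samePair-to σ a b x y)))

addPair-deleteEdge : (G : Graph) → SimpleGraph G → (e : Edge G) → G ≅ addPair (deleteEdge G e) (u e) (v e)
addPair-deleteEdge G (G-sym , _) e = ≅-pointwise restore
  where
  restore : ∀ x y → adj G x y ≡ ((adj G x y ∧ not (samePair (u e) (v e) x y)) ∨ samePair (u e) (v e) x y)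
  restore x y with samePair (u e) (v e) x y in same
  ... | false = sym (trans (∨-identityʳ _) (∧-identityʳ _))
  ... | true with samePair⇒ (u e) (v e) x y same
  ...   | inj₁ (refl , refl) = trans (isAdj e) (sym (∨-zeroʳ _))
  ...   | inj₂ (refl , refl) = trans (trans (G-sym _ _) (isAdj e)) (sym (∨-zeroʳ _))

IsolatedEdge : Graph → Set
IsolatedEdge X = Σ (Fin (order X)) λ s → Σ (Fin (order X)) λ t → adj X s t ≡ true × vdeg X s ≡ 1 × vdeg X t ≡ 1

IsolatedEdge-≅ : {X Y : Graph} → X ≅ Y → IsolatedEdge X → IsolatedEdge Y
IsolatedEdge-≅ {X} {Y} φ (s , t , st , deg-s , deg-t) =
  to s , to t , trans (sym (proj₂ φ s t)) st , trans (vdeg-≅ {X} {Y} φ s) deg-s , trans (vdeg-≅ {X} {Y} φ t) deg-t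
  where to = Inverse.to (proj₁ φ)

involution-≅ : ∀ {k} (A B : Fin k → Fin k → Bool) (τ : Fin k → Fin k) → (∀ x → τ (τ x) ≡ x) →
               (∀ x y → A x y ≡ true → B (τ x) (τ y) ≡ true) →
               (∀ x y → B x y ≡ true → A (τ x) (τ y) ≡ true) →
               mkGraph k A ≅ mkGraph k B
involution-≅ A B τ τ-involutive forward backward = mk↔ₛ′ τ τ τ-involutive τ-involutive , preserves
  where
  preserves : ∀ x y → A x y ≡ B (τ x) (τ y)
  preserves x y with A x y in Axy | B (τ x) (τ y) in Bτ
  ... | true  | true  = refl
  ... | false | false = refl
  ... | true  | false = trans (sym (forward x y Axy)) Bτ
  ... | false | true  = trans (sym Axy) (subst₂ (λ s t → A s t ≡ true) (τ-involutive x) (τ-involutive y) (backward _ _ Bτ))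

involution-fromℕ : ∀ {k} (σ : ℕ → ℕ) → (∀ a → a < k → σ a < k) → (∀ a → a < k → σ (σ a) ≡ a) →
                   Σ (Fin k → Fin k) λ τ → (∀ x → toℕ (τ x) ≡ σ (toℕ x)) × (∀ x → τ (τ x) ≡ x)
involution-fromℕ σ bound involutive = τ , toℕ-τ , λ x →
  toℕ-injective (trans (toℕ-τ (τ x)) (trans (cong σ (toℕ-τ x)) (involutive (toℕ x) (toℕ<n x))))
  where
  τ = λ x → fromℕ< (bound (toℕ x) (toℕ<n x))
  toℕ-τ : ∀ x → toℕ (τ x) ≡ σ (toℕ x)
  toℕ-τ x = toℕ-fromℕ< (bound (toℕ x) (toℕ<n x))

-- The degree of an edge

module _ (G : Graph) (simple : SimpleGraph G) (e : Edge G) where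
  private
    open ≡-Reasoning
    G-sym = proj₁ simple
    G-irr = proj₂ simple
    U = u e
    V = v e
    U≢V = edge≢ e
    A = adj (deleteEdge G e)
    d′ = vdeg (deleteEdge G e)
    endpoint : Fin (order G) → Bool
    endpoint x = x == U ∨ x == V

    A-sym : ∀ x y → A x y ≡ A y x
    A-sym x y = cong₂ _∧_ (G-sym x y) (cong not (samePair-flip U V x y))

    endpoint⇒ : ∀ x → endpoint x ≡ true → x ≡ U ⊎ x ≡ V
    endpoint⇒ x h with x == U in xU
    ... | true = inj₁ (==⇒≡ x U xU)
    ... | false = inj₂ (==⇒≡ x V h)

    A-endpoints : ∀ x y → endpoint x ≡ true → endpoint y ≡ true → A x y ≡ false
    A-endpoints x y ex ey with endpoint⇒ x ex | endpoint⇒ y ey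
    ... | inj₁ refl | inj₁ refl rewrite G-irr x = refl
    ... | inj₂ refl | inj₂ refl rewrite G-irr x = refl
    ... | inj₁ refl | inj₂ refl rewrite samePair-self U V = ∧-zeroʳ _
    ... | inj₂ refl | inj₁ refl rewrite samePair-flip U V V U | samePair-self U V = ∧-zeroʳ _

    disjoint : ∀ x y → ((A x y ∧ endpoint x) ∧ (A x y ∧ endpoint y)) ≡ false
    disjoint x y with endpoint x in ex
    ... | false = cong (_∧ (A x y ∧ endpoint y)) (∧-zeroʳ (A x y))
    ... | true with endpoint y in ey
    ...   | false = trans (cong ((A x y ∧ true) ∧_) (∧-zeroʳ (A x y))) (∧-zeroʳ _)
    ...   | true rewrite A-endpoints x y ex ey = refl

    at-source : sum (λ x → countFin (λ y → A x y ∧ endpoint x)) ≡ d′ U + d′ V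
    at-source = begin
      sum (λ x → countFin (λ y → A x y ∧ endpoint x))
        ≡⟨ sum-cong-≗ (λ x → countFin-∧-const x (endpoint x)) ⟩
      sum (λ x → if endpoint x then d′ x else 0)
        ≡⟨ sum-if-∨ U V U≢V d′ ⟩
      d′ U + d′ V ∎
      where
      countFin-∧-const : ∀ x b → countFin (λ y → A x y ∧ b) ≡ (if b then d′ x else 0)
      countFin-∧-const x true  = trans (countFin-cong (λ y → ∧-identityʳ (A x y))) (sym (vdeg≡countFin (deleteEdge G e) x))
      countFin-∧-const x false = countFin-false (λ y → ∧-zeroʳ (A x y))

    at-target : sum (λ x → countFin (λ y → A x y ∧ endpoint y)) ≡ d′ U + d′ V
    at-target = begin
      sum (λ x → sum (λ y → indicator (A x y ∧ endpoint y)))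
        ≡⟨ ∑-comm (λ x y → indicator (A x y ∧ endpoint y)) ⟩
      sum (λ y → sum (λ x → indicator (A x y ∧ endpoint y)))
        ≡⟨ sum-cong-≗ (λ y → countFin-cong (λ x → cong (_∧ endpoint y) (A-sym x y))) ⟩
      sum (λ y → countFin (λ x → A y x ∧ endpoint y))
        ≡⟨ at-source ⟩
      d′ U + d′ V ∎

    Q : Fin (order G) → Fin (order G) → Bool
    Q x y = adj G x y ∧ not (samePair U V x y) ∧ (x == U ∨ x == V ∨ y == U ∨ y == V)

    Q-split : ∀ x y → Q x y ≡ ((A x y ∧ endpoint x) ∨ (A x y ∧ endpoint y))
    Q-split x y = begin
      Q x y                                   ≡⟨ ∧-assoc (adj G x y) _ _ ⟨
      A x y ∧ (x == U ∨ x == V ∨ y == U ∨ y == V) ≡⟨ cong (A x y ∧_) (∨-assoc (x == U) (x == V) (endpoint y)) ⟨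
      A x y ∧ (endpoint x ∨ endpoint y)       ≡⟨ ∧-distribˡ-∨ (A x y) (endpoint x) (endpoint y) ⟩
      (A x y ∧ endpoint x) ∨ (A x y ∧ endpoint y) ∎

    Q-sym : ∀ x y → Q x y ≡ Q y x
    Q-sym x y = trans (Q-split x y) (trans (∨-comm (A x y ∧ endpoint x) (A x y ∧ endpoint y))
      (trans (cong₂ (λ s t → (s ∧ endpoint y) ∨ (t ∧ endpoint x)) (A-sym x y) (A-sym x y)) (sym (Q-split y x))))

    Q-irr : ∀ x → Q x x ≡ false
    Q-irr x rewrite G-irr x = refl

    all-Q : sum (λ x → countFin (Q x)) ≡ (d′ U + d′ V) + (d′ U + d′ V)
    all-Q = begin
      sum (λ x → countFin (Q x))
        ≡⟨ sum-cong-≗ (λ x → trans (countFin-cong (Q-split x))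
                                   (countFin-∨ (λ y → A x y ∧ endpoint x) (λ y → A x y ∧ endpoint y) (disjoint x))) ⟩
      sum (λ x → countFin (λ y → A x y ∧ endpoint x) + countFin (λ y → A x y ∧ endpoint y))
        ≡⟨ ∑-distrib-+ (λ x → countFin (λ y → A x y ∧ endpoint x)) (λ x → countFin (λ y → A x y ∧ endpoint y)) ⟩
      sum (λ x → countFin (λ y → A x y ∧ endpoint x)) + sum (λ x → countFin (λ y → A x y ∧ endpoint y))
        ≡⟨ cong₂ _+_ at-source at-target ⟩
      (d′ U + d′ V) + (d′ U + d′ V) ∎

  -- Summing over ordered pairs counts each edge of G - e at an end of e once from that end;
  -- no edge of G - e joins the two ends of e.
  edeg≡vdeg+vdeg-deleteEdge : edeg G e ≡ vdeg (deleteEdge G e) (u e) + vdeg (deleteEdge G e) (v e)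
  edeg≡vdeg+vdeg-deleteEdge = +-double-injective _ _ (begin
    edeg G e + edeg G e           ≡⟨ cong₂ _+_ (count-pairs (order G) _) (count-pairs (order G) _) ⟩
    countUpper Q + countUpper Q   ≡⟨ countUpper-double Q Q-sym Q-irr ⟩
    sum (λ x → countFin (Q x))    ≡⟨ all-Q ⟩
    (d′ U + d′ V) + (d′ U + d′ V) ∎)

edeg+2≡vdeg+vdeg : (G : Graph) → SimpleGraph G → (e : Edge G) → edeg G e + 2 ≡ vdeg G (u e) + vdeg G (v e)
edeg+2≡vdeg+vdeg G simple e = begin
  edeg G e + 2                          ≡⟨ cong (_+ 2) (edeg≡vdeg+vdeg-deleteEdge G simple e) ⟩
  (d′ U + d′ V) + 2                     ≡⟨ +-comm (d′ U + d′ V) 2 ⟩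
  suc (suc (d′ U + d′ V))               ≡⟨ cong suc (+-suc (d′ U) (d′ V)) ⟨
  suc (d′ U) + suc (d′ V)               ≡⟨ cong (λ t → suc (d′ U) + suc t) (vdeg-deletePair-comm G U V V) ⟩
  suc (d′ U) + suc (vdeg (deletePair G V U) V)
    ≡⟨ cong₂ _+_ (vdeg-deletePair-endpoint G (edge≢ e) (isAdj e))
                 (vdeg-deletePair-endpoint G (edge≢ e ∘ sym) (trans (proj₁ simple V U) (isAdj e))) ⟨
  vdeg G U + vdeg G V ∎
  where
  open ≡-Reasoning
  U = u e
  V = v e
  d′ = vdeg (deleteEdge G e)

-- Reconstructing from a leaf decard and a middle decard

addPair-from : (X Y : Graph) → SimpleGraph Y → (f : Edge Y) (φ : X ≅ deleteEdge Y f) →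
               addPair X (Inverse.from (proj₁ φ) (u f)) (Inverse.from (proj₁ φ) (v f)) ≅ Y
addPair-from X Y simpleY f (σ , pres) = σ , λ x y → begin
  adj X x y ∨ samePair (from (u f)) (from (v f)) x y
    ≡⟨ cong₂ _∨_ (pres x y) (sym (samePair-to σ (from (u f)) (from (v f)) x y)) ⟩
  adj (deleteEdge Y f) (to x) (to y) ∨ samePair (to (from (u f))) (to (from (v f))) (to x) (to y)
    ≡⟨ cong₂ (λ s t → adj (deleteEdge Y f) (to x) (to y) ∨ samePair s t (to x) (to y)) (to-from σ (u f)) (to-from σ (v f)) ⟩
  adj (deleteEdge Y f) (to x) (to y) ∨ samePair (u f) (v f) (to x) (to y)
    ≡⟨ proj₂ (addPair-deleteEdge Y simpleY f) (to x) (to y) ⟨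
  adj Y (to x) (to y) ∎
  where
  open ≡-Reasoning
  to = Inverse.to σ
  from = Inverse.from σ

module PulledBackEdge {X Y : Graph} (ψ : X ≅ Y) (f : Edge Y) where
  private
    σ = proj₁ ψ
    to = Inverse.to σ
    from = Inverse.from σ

  a b : Fin (order X)
  a = from (u f)
  b = from (v f)

  adjacent : adj X a b ≡ true
  adjacent = trans (proj₂ ψ a b) (trans (cong₂ (adj Y) (to-from σ (u f)) (to-from σ (v f))) (isAdj f))

  a≢b : ¬ a ≡ b
  a≢b a≡b = edge≢ f (trans (sym (to-from σ (u f))) (trans (cong to a≡b) (to-from σ (v f))))

  vdeg-a : vdeg X a ≡ vdeg Y (u f)
  vdeg-a = trans (sym (vdeg-≅ {X} {Y} ψ a)) (cong (vdeg Y) (to-from σ (u f)))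

  vdeg-b : vdeg X b ≡ vdeg Y (v f)
  vdeg-b = trans (sym (vdeg-≅ {X} {Y} ψ b)) (cong (vdeg Y) (to-from σ (v f)))

  deleted : deletePair X a b ≅ deleteEdge Y f
  deleted = σ , λ x y → trans (proj₂ (deletePair-≅ {X} {Y} ψ a b) x y)
    (cong₂ (λ s t → adj Y (to x) (to y) ∧ not (samePair s t (to x) (to y))) (to-from σ (u f)) (to-from σ (v f)))

reattachLeaf : (G : Graph) → Edge G → Fin (order G) → Graph
reattachLeaf G e x = addPair (deleteEdge G e) (v e) x

vdeg-deleteEdge-v : (G : Graph) → SimpleGraph G → (e : Edge G) → vdeg G (v e) ≡ suc (vdeg (deleteEdge G e) (v e))
vdeg-deleteEdge-v G (G-sym , _) e = trans
  (vdeg-deletePair-endpoint G (edge≢ e ∘ sym) (trans (G-sym (v e) (u e)) (isAdj e)))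
  (cong suc (vdeg-deletePair-comm G (v e) (u e) (v e)))

module _ (G : Graph) (simpleG : SimpleGraph G) (e : Edge G) (leaf : vdeg G (v e) ≡ 1) where
  private
    G₁ = deleteEdge G e
    ℓ = v e

  vdeg-deleteEdge-leaf : vdeg G₁ ℓ ≡ 0
  vdeg-deleteEdge-leaf = suc-injective (trans (sym (vdeg-deleteEdge-v G simpleG e)) leaf)

  deleteEdge-leaf-isolated : ∀ y → adj G₁ ℓ y ≡ false
  deleteEdge-leaf-isolated = countFin≡0 (adj G₁ ℓ) (trans (sym (vdeg≡countFin G₁ ℓ)) vdeg-deleteEdge-leaf)

  vdeg-reattachLeaf-leaf : ∀ {x} → ¬ ℓ ≡ x → vdeg (reattachLeaf G e x) ℓ ≡ 1
  vdeg-reattachLeaf-leaf ℓ≢x =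
    trans (vdeg-addPair-endpoint G₁ ℓ≢x (deleteEdge-leaf-isolated _)) (cong suc vdeg-deleteEdge-leaf)

  vdeg-reattachLeaf-target : ∀ {x} → ¬ ℓ ≡ x → vdeg (reattachLeaf G e x) x ≡ suc (vdeg G₁ x)
  vdeg-reattachLeaf-target {x} ℓ≢x = trans (vdeg-addPair-comm G₁ ℓ x x)
    (vdeg-addPair-endpoint G₁ (ℓ≢x ∘ sym)
      (trans (deletePair-symmetric G (u e) ℓ (proj₁ simpleG) x ℓ) (deleteEdge-leaf-isolated x)))

reattachLeaf-origin : (G : Graph) → SimpleGraph G → (e : Edge G) → reattachLeaf G e (u e) ≅ G
reattachLeaf-origin G simpleG e =
  ≅-trans {reattachLeaf G e (u e)} {addPair (deleteEdge G e) (u e) (v e)} {G}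
    (≅-pointwise (λ s t → cong (adj (deleteEdge G e) s t ∨_) (samePair-comm (v e) (u e) s t)))
    (≅-sym {G} {addPair (deleteEdge G e) (u e) (v e)} (addPair-deleteEdge G simpleG e))

record LeafReattachment (G : Graph) (e₁ e₂ : Edge G) : Set where
  field
    x              : Fin (order G)
    leaf≢x         : ¬ v e₁ ≡ x
    degree-balance : suc (suc (vdeg (deleteEdge G e₁) x)) ≡ vdeg G (u e₁) + vdeg G (v e₁)
    a b            : Fin (order G)
    a≢b            : ¬ a ≡ b
    ab-edge        : adj (reattachLeaf G e₁ x) a b ≡ true
    vdeg-a         : vdeg (reattachLeaf G e₁ x) a ≡ 2
    vdeg-b         : vdeg (reattachLeaf G e₁ x) b ≡ 2
    deleted-ab     : deletePair (reattachLeaf G e₁ x) a b ≅ deleteEdge G e₂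

module _ {G H : Graph} (simpleG : SimpleGraph G) (simpleH : SimpleGraph H)
         {e₁ e₂ : Edge G} (leaf : vdeg G (v e₁) ≡ 1)
         (e₂-deg : edeg G e₂ ≡ 2) (no-isolated : ∀ w → 1 ≤ vdeg (deleteEdge G e₂) w)
         {f₁ f₂ : Edge H}
         (φ₁ : deleteEdge G e₁ ≅ deleteEdge H f₁) (d₁ : edeg G e₁ ≡ edeg H f₁)
         (φ₂ : deleteEdge G e₂ ≅ deleteEdge H f₂) (d₂ : edeg G e₂ ≡ edeg H f₂) where

  private
    G₁ = deleteEdge G e₁
    ℓ = v e₁
    a₁ = Inverse.from (proj₁ φ₁) (u f₁)
    b₁ = Inverse.from (proj₁ φ₁) (v f₁)
    G′ = addPair G₁ a₁ b₁

    G′≅H : G′ ≅ H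
    G′≅H = addPair-from G₁ H simpleH f₁ φ₁

    module F₁ = PulledBackEdge {G′} {H} G′≅H f₁
    module F₂ = PulledBackEdge {G′} {H} G′≅H f₂
    a₂ = F₂.a
    b₂ = F₂.b

    G′-f₂≅G-e₂ : deletePair G′ a₂ b₂ ≅ deleteEdge G e₂
    G′-f₂≅G-e₂ = ≅-trans {deletePair G′ a₂ b₂} {deleteEdge H f₂} {deleteEdge G e₂} F₂.deleted
                         (≅-sym {deleteEdge G e₂} {deleteEdge H f₂} φ₂)

    no-isolated′ : ∀ w → 1 ≤ vdeg (deletePair G′ a₂ b₂) w
    no-isolated′ w = subst (1 ≤_) (vdeg-≅ {deletePair G′ a₂ b₂} {deleteEdge G e₂} G′-f₂≅G-e₂ w) (no-isolated _)

    -- ℓ is isolated in G - e₁, but no vertex is isolated in H - f₂ ≅ G - e₂; so ℓ is an end of the added edge.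
    ℓ-endpoint : ℓ ≡ a₁ ⊎ ℓ ≡ b₁
    ℓ-endpoint with ℓ ≟ᶠ a₁ | ℓ ≟ᶠ b₁
    ... | yes ℓ≡a₁ | _         = inj₁ ℓ≡a₁
    ... | no _     | yes ℓ≡b₁  = inj₂ ℓ≡b₁
    ... | no ℓ≢a₁  | no ℓ≢b₁   = ⊥-elim (<⇒≱ (no-isolated′ ℓ) (begin
      vdeg (deletePair G′ a₂ b₂) ℓ ≤⟨ vdeg-deletePair-≤ G′ a₂ b₂ ℓ ⟩
      vdeg G′ ℓ                    ≡⟨ vdeg-addPair-other G₁ ℓ≢a₁ ℓ≢b₁ ⟩
      vdeg G₁ ℓ                    ≡⟨ vdeg-deleteEdge-leaf G simpleG e₁ leaf ⟩
      0 ∎))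
      where open ≤-Reasoning

    vdeg-G′≥2 : ∀ {s t} → ¬ s ≡ t → adj G′ s t ≡ true → 1 ≤ vdeg (deletePair G′ s t) s → 2 ≤ vdeg G′ s
    vdeg-G′≥2 s≢t st 1≤ = subst (2 ≤_) (sym (vdeg-deletePair-endpoint G′ s≢t st)) (s≤s 1≤)

    G₁-sym : Symmetric G₁
    G₁-sym = deletePair-symmetric G (u e₁) ℓ (proj₁ simpleG)

    G′-sym : Symmetric G′
    G′-sym = addPair-symmetric G₁ a₁ b₁ G₁-sym

    vdeg-a₂b₂ : vdeg G′ a₂ ≡ 2 × vdeg G′ b₂ ≡ 2
    vdeg-a₂b₂ = both-two sum≡4
      (vdeg-G′≥2 F₂.a≢b F₂.adjacent (no-isolated′ a₂))
      (vdeg-G′≥2 (F₂.a≢b ∘ sym) (trans (G′-sym b₂ a₂) F₂.adjacent)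
        (subst (1 ≤_) (vdeg-deletePair-comm G′ a₂ b₂ b₂) (no-isolated′ b₂)))
      where
      sum≡4 : vdeg G′ a₂ + vdeg G′ b₂ ≡ 4
      sum≡4 = begin
        vdeg G′ a₂ + vdeg G′ b₂       ≡⟨ cong₂ _+_ F₂.vdeg-a F₂.vdeg-b ⟩
        vdeg H (u f₂) + vdeg H (v f₂) ≡⟨ edeg+2≡vdeg+vdeg H simpleH f₂ ⟨
        edeg H f₂ + 2                 ≡⟨ cong (_+ 2) (trans (sym d₂) e₂-deg) ⟩
        4 ∎
        where open ≡-Reasoning

    record OtherEnd : Set where
      field
        x          : Fin (order G)
        ℓ≢x        : ¬ ℓ ≡ x
        same-graph : ∀ s t → adj (reattachLeaf G e₁ x) s t ≡ adj G′ s t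
        balance    : vdeg G′ ℓ + vdeg G′ x ≡ vdeg G′ a₁ + vdeg G′ b₁

    otherEnd : OtherEnd
    otherEnd with ℓ-endpoint
    ... | inj₁ ℓ≡a₁ = record
      { x = b₁
      ; ℓ≢x = λ ℓ≡b₁ → F₁.a≢b (trans (sym ℓ≡a₁) ℓ≡b₁)
      ; same-graph = λ s t → cong (λ z → adj G₁ s t ∨ samePair z b₁ s t) ℓ≡a₁
      ; balance = cong (λ z → vdeg G′ z + vdeg G′ b₁) ℓ≡a₁ }
    ... | inj₂ ℓ≡b₁ = record
      { x = a₁
      ; ℓ≢x = λ ℓ≡a₁ → F₁.a≢b (trans (sym ℓ≡a₁) ℓ≡b₁)
      ; same-graph = λ s t → trans (cong (λ z → adj G₁ s t ∨ samePair z a₁ s t) ℓ≡b₁)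
                                   (cong (adj G₁ s t ∨_) (samePair-comm b₁ a₁ s t))
      ; balance = trans (cong (λ z → vdeg G′ z + vdeg G′ a₁) ℓ≡b₁) (+-comm (vdeg G′ b₁) (vdeg G′ a₁)) }

    open OtherEnd otherEnd

    G″ = reattachLeaf G e₁ x

    G″≅G′ : G″ ≅ G′
    G″≅G′ = ≅-pointwise same-graph

    vdeg-G″ : ∀ w → vdeg G″ w ≡ vdeg G′ w
    vdeg-G″ w = sym (vdeg-≅ {G″} {G′} G″≅G′ w)

  reattachment : Σ (LeafReattachment G e₁ e₂) λ r → H ≅ reattachLeaf G e₁ (LeafReattachment.x r)
  reattachment = record
    { x = x
    ; leaf≢x = ℓ≢x
    ; degree-balance = degree-balance
    ; a = a₂ ; b = b₂ ; a≢b = F₂.a≢b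
    ; ab-edge = trans (same-graph a₂ b₂) F₂.adjacent
    ; vdeg-a = trans (vdeg-G″ a₂) (proj₁ vdeg-a₂b₂)
    ; vdeg-b = trans (vdeg-G″ b₂) (proj₂ vdeg-a₂b₂)
    ; deleted-ab = ≅-trans {deletePair G″ a₂ b₂} {deletePair G′ a₂ b₂} {deleteEdge G e₂}
                 (≅-pointwise (λ s t → cong (_∧ not (samePair a₂ b₂ s t)) (same-graph s t))) G′-f₂≅G-e₂
    } , ≅-trans {H} {G′} {G″} (≅-sym {G′} {H} G′≅H) (≅-sym {G″} {G′} G″≅G′)
    where
    open ≡-Reasoning
    degree-balance : suc (suc (vdeg G₁ x)) ≡ vdeg G (u e₁) + vdeg G ℓ
    degree-balance = begin
      suc (suc (vdeg G₁ x))            ≡⟨ cong₂ _+_ (vdeg-reattachLeaf-leaf G simpleG e₁ leaf ℓ≢x) (vdeg-reattachLeaf-target G simpleG e₁ leaf ℓ≢x) ⟨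
      vdeg G″ ℓ + vdeg G″ x            ≡⟨ cong₂ _+_ (vdeg-G″ ℓ) (vdeg-G″ x) ⟩
      vdeg G′ ℓ + vdeg G′ x            ≡⟨ balance ⟩
      vdeg G′ a₁ + vdeg G′ b₁          ≡⟨ cong₂ _+_ F₁.vdeg-a F₁.vdeg-b ⟩
      vdeg H (u f₁) + vdeg H (v f₁)    ≡⟨ edeg+2≡vdeg+vdeg H simpleH f₁ ⟨
      edeg H f₁ + 2                    ≡⟨ cong (_+ 2) d₁ ⟨
      edeg G e₁ + 2                    ≡⟨ edeg+2≡vdeg+vdeg G simpleG e₁ ⟩
      vdeg G (u e₁) + vdeg G ℓ ∎

-- Double brooms

module DoubleBroomStructure (m n q : ℕ) where

  p N : ℕ
  p = suc (suc q)
  N = p + m + n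

  LeftLeaf RightLeaf : ℕ → Set
  LeftLeaf a = p ≤ a × a < p + m
  RightLeaf a = p + m ≤ a × a < N

  data Arc (a b : ℕ) : Set where
    spine : suc a ≡ b → b < p → Arc a b
    left  : a ≡ 0 → LeftLeaf b → Arc a b
    right : a ≡ suc q → RightLeaf b → Arc a b

  Adjacent : ℕ → ℕ → Set
  Adjacent a b = Arc a b ⊎ Arc b a

  adjacency : ℕ → ℕ → Bool
  adjacency = broomAdjℕ m n p

  private
    open Equivalence
    T-∧³ : ∀ {x y z} → T (x ∧ y ∧ z) → T x × T y × T z
    T-∧³ xyz = let x , yz = to T-∧ xyz in x , to T-∧ yz

    ∧-true : ∀ {x y} → x ≡ true → y ≡ true → (x ∧ y) ≡ true
    ∧-true refl refl = refl
    ∨-trueˡ : ∀ {x} y → x ≡ true → (x ∨ y) ≡ true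
    ∨-trueˡ y refl = refl
    ∨-trueʳ : ∀ x {y} → y ≡ true → (x ∨ y) ≡ true
    ∨-trueʳ x refl = ∨-zeroʳ x

    spine? leftLeaf? rightLeaf? : ℕ → ℕ → Bool
    spine? a b = (a <ᵇ p) ∧ (b <ᵇ p) ∧ ((suc a ≡ᵇ b) ∨ (suc b ≡ᵇ a))
    leftLeaf? x y = (x ≡ᵇ 0) ∧ (p ≤ᵇ y) ∧ (y <ᵇ p + m)
    rightLeaf? x y = (x ≡ᵇ suc q) ∧ (p + m ≤ᵇ y) ∧ (y <ᵇ p + m + n)

    left-sound : ∀ {a b} → T (leftLeaf? a b) → Arc a b
    left-sound {a} {b} h with T-∧³ h
    ... | a≡0 , p≤b , b<p+m = left (≡ᵇ⇒≡ a 0 a≡0) (≤ᵇ⇒≤ p b p≤b , <ᵇ⇒< b (p + m) b<p+m)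

    right-sound : ∀ {a b} → T (rightLeaf? a b) → Arc a b
    right-sound {a} {b} h with T-∧³ h
    ... | a≡e , p+m≤b , b<N = right (≡ᵇ⇒≡ a (suc q) a≡e) (≤ᵇ⇒≤ (p + m) b p+m≤b , <ᵇ⇒< b N b<N)

  adjacency-sound : ∀ a b → adjacency a b ≡ true → Adjacent a b
  adjacency-sound a b h with to T-∨ (from T-≡ h)
  ... | inj₁ spine? with T-∧³ spine?
  ...   | a<p , b<p , succ with to T-∨ succ
  ...     | inj₁ 1+a≡b = inj₁ (spine (≡ᵇ⇒≡ (suc a) b 1+a≡b) (<ᵇ⇒< b p b<p))
  ...     | inj₂ 1+b≡a = inj₂ (spine (≡ᵇ⇒≡ (suc b) a 1+b≡a) (<ᵇ⇒< a p a<p))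
  adjacency-sound a b h | inj₂ leaves with to T-∨ leaves
  ... | inj₁ ab = inj₁ (left-sound ab)
  ... | inj₂ leaves with to T-∨ leaves
  ...   | inj₁ ba = inj₂ (left-sound ba)
  ...   | inj₂ leaves with to T-∨ leaves
  ...     | inj₁ ab = inj₁ (right-sound ab)
  ...     | inj₂ ba = inj₂ (right-sound ba)

  adjacency-complete : ∀ a b → Adjacent a b → adjacency a b ≡ true
  adjacency-complete a b (inj₁ (spine refl b<p)) =
    ∨-trueˡ _ (∧-true (<ᵇ-true (<-trans (n<1+n a) b<p)) (∧-true (<ᵇ-true b<p) (∨-trueˡ _ (≡ᵇ-refl a))))
  adjacency-complete a b (inj₂ (spine refl a<p)) =
    ∨-trueˡ _ (∧-true (<ᵇ-true a<p) (∧-true (<ᵇ-true (<-trans (n<1+n b) a<p)) (∨-trueʳ _ (≡ᵇ-refl b))))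
  adjacency-complete a b (inj₁ (left refl (p≤b , b<p+m))) =
    ∨-trueʳ (spine? 0 b) (∨-trueˡ _ (∧-true refl (∧-true (≤ᵇ-true p≤b) (<ᵇ-true b<p+m))))
  adjacency-complete a b (inj₂ (left refl (p≤a , a<p+m))) =
    ∨-trueʳ (spine? a 0) (∨-trueʳ (leftLeaf? a 0) (∨-trueˡ _ (∧-true refl (∧-true (≤ᵇ-true p≤a) (<ᵇ-true a<p+m)))))
  adjacency-complete a b (inj₁ (right refl (p+m≤b , b<N))) =
    ∨-trueʳ (spine? (suc q) b) (∨-trueʳ (leftLeaf? (suc q) b) (∨-trueʳ (leftLeaf? b (suc q)) (∨-trueˡ _ (∧-true (≡ᵇ-refl q) (∧-true (≤ᵇ-true p+m≤b) (<ᵇ-true b<N))))))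
  adjacency-complete a b (inj₂ (right refl (p+m≤a , a<N))) =
    ∨-trueʳ (spine? a (suc q)) (∨-trueʳ (leftLeaf? a (suc q)) (∨-trueʳ (leftLeaf? (suc q) a)
      (∨-trueʳ (rightLeaf? a (suc q)) (∧-true (≡ᵇ-refl q) (∧-true (≤ᵇ-true p+m≤a) (<ᵇ-true a<N))))))

  adjacency-false : ∀ a b → ¬ Adjacent a b → adjacency a b ≡ false
  adjacency-false a b ¬ab with adjacency a b in ab
  ... | false = refl
  ... | true = ⊥-elim (¬ab (adjacency-sound a b ab))

  adjacency-sym : ∀ a b → adjacency a b ≡ adjacency b a
  adjacency-sym a b with adjacency a b in ab | adjacency b a in ba
  ... | true  | true  = refl
  ... | false | false = refl
  ... | true  | false = sym (trans (sym ba) (adjacency-complete b a (swap (adjacency-sound a b ab))))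
  ... | false | true  = trans (sym ab) (adjacency-complete a b (swap (adjacency-sound b a ba)))

  p≤p+m : p ≤ p + m
  p≤p+m = m≤m+n p m

  p+m≤N : p + m ≤ N
  p+m≤N = m≤m+n (p + m) n

  Arc⇒< : ∀ {a b} → Arc a b → a < b
  Arc⇒< (spine refl _)      = n<1+n _
  Arc⇒< (left refl (p≤b , _)) = ≤-trans (s≤s z≤n) p≤b
  Arc⇒< (right refl (p+m≤b , _)) = ≤-trans (≤-trans (n<1+n (suc q)) p≤p+m) p+m≤b

  Adjacent-irrefl : ∀ a → ¬ Adjacent a a
  Adjacent-irrefl a (inj₁ arc) = <-irrefl refl (Arc⇒< arc)
  Adjacent-irrefl a (inj₂ arc) = <-irrefl refl (Arc⇒< arc)

  Adjacent⇒Arc : ∀ {a b} → a < b → Adjacent a b → Arc a b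
  Adjacent⇒Arc a<b (inj₁ arc) = arc
  Adjacent⇒Arc a<b (inj₂ arc) = ⊥-elim (<-asym a<b (Arc⇒< arc))

  adjacency-irrefl : ∀ a → adjacency a a ≡ false
  adjacency-irrefl a = adjacency-false a a (Adjacent-irrefl a)

  leftLeaf-neighbour : ∀ {a b} → LeftLeaf a → Adjacent a b → b ≡ 0
  leftLeaf-neighbour (p≤a , _)   (inj₁ (spine refl b<p))     = ⊥-elim (<⇒≱ (<-trans (n<1+n _) b<p) p≤a)
  leftLeaf-neighbour (() , _)    (inj₁ (left refl _))
  leftLeaf-neighbour (p≤a , _)   (inj₁ (right refl _))       = ⊥-elim (<⇒≱ (n<1+n (suc q)) p≤a)
  leftLeaf-neighbour (p≤a , _)   (inj₂ (spine refl a<p))     = ⊥-elim (<⇒≱ a<p p≤a)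
  leftLeaf-neighbour _           (inj₂ (left b≡0 _))         = b≡0
  leftLeaf-neighbour (_ , a<p+m) (inj₂ (right _ (p+m≤a , _))) = ⊥-elim (<⇒≱ a<p+m p+m≤a)

  rightLeaf-neighbour : ∀ {a b} → RightLeaf a → Adjacent a b → b ≡ suc q
  rightLeaf-neighbour (p+m≤a , _) (inj₁ (spine refl b<p)) =
    ⊥-elim (<⇒≱ (<-trans (n<1+n _) b<p) (≤-trans p≤p+m p+m≤a))
  rightLeaf-neighbour (() , _)    (inj₁ (left refl _))
  rightLeaf-neighbour (p+m≤a , _) (inj₁ (right refl _)) = ⊥-elim (<⇒≱ (n<1+n (suc q)) (≤-trans p≤p+m p+m≤a))
  rightLeaf-neighbour (p+m≤a , _) (inj₂ (spine refl a<p)) = ⊥-elim (<⇒≱ a<p (≤-trans p≤p+m p+m≤a))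
  rightLeaf-neighbour (p+m≤a , _) (inj₂ (left _ (_ , a<p+m))) = ⊥-elim (<⇒≱ a<p+m p+m≤a)
  rightLeaf-neighbour _           (inj₂ (right b≡e _)) = b≡e

  leftEnd-neighbour : ∀ {b} → Adjacent 0 b → b ≡ 1 ⊎ LeftLeaf b
  leftEnd-neighbour (inj₁ (spine refl _))  = inj₁ refl
  leftEnd-neighbour (inj₁ (left _ leaf))   = inj₂ leaf
  leftEnd-neighbour (inj₂ arc)             = ⊥-elim (<⇒≱ (Arc⇒< arc) z≤n)

  rightEnd-neighbour : ∀ {b} → Adjacent (suc q) b → b ≡ q ⊎ RightLeaf b
  rightEnd-neighbour (inj₁ (spine refl b<p))      = ⊥-elim (<-irrefl refl b<p)
  rightEnd-neighbour (inj₁ (right _ leaf))        = inj₂ leaf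
  rightEnd-neighbour (inj₂ (spine refl _))        = inj₁ refl
  rightEnd-neighbour (inj₂ (left _ (p≤e , _)))    = ⊥-elim (<⇒≱ (n<1+n (suc q)) p≤e)
  rightEnd-neighbour (inj₂ (right _ (p+m≤e , _))) = ⊥-elim (<⇒≱ (n<1+n (suc q)) (≤-trans p≤p+m p+m≤e))

  interior-neighbour : ∀ {i b} → i < q → Adjacent (suc i) b → b ≡ i ⊎ b ≡ suc (suc i)
  interior-neighbour i<q (inj₁ (spine refl _))        = inj₂ refl
  interior-neighbour i<q (inj₁ (right refl _))        = ⊥-elim (<-irrefl refl i<q)
  interior-neighbour i<q (inj₂ (spine refl _))        = inj₁ refl
  interior-neighbour i<q (inj₂ (left _ (p≤a , _)))    = ⊥-elim (<⇒≱ (s≤s (m<n⇒m<1+n i<q)) p≤a)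
  interior-neighbour i<q (inj₂ (right _ (p+m≤a , _))) = ⊥-elim (<⇒≱ (s≤s (m<n⇒m<1+n i<q)) (≤-trans p≤p+m p+m≤a))

  deg : ℕ → ℕ
  deg a = countBelow (adjacency a) N

  private
    no-edge : ∀ {a b} → ¬ Adjacent a b → adjacency a b ≡ false
    no-edge = adjacency-false _ _
    edge : ∀ {a b} → Adjacent a b → adjacency a b ≡ true
    edge = adjacency-complete _ _

  deg-leftLeaf : ∀ {a} → LeftLeaf a → deg a ≡ 1
  deg-leftLeaf {a} leaf = begin
    deg a                          ≡⟨ countBelow-false (adjacency a) N (s≤s z≤n) only0 ⟩
    0 + indicator (adjacency a 0)  ≡⟨ cong indicator (edge (inj₂ (left refl leaf))) ⟩
    1 ∎
    where
    open ≡-Reasoning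
    only0 : ∀ b → 1 ≤ b → b < N → adjacency a b ≡ false
    only0 b 1≤b _ = no-edge λ ab → <⇒≱ (subst (_< 1) (sym (leftLeaf-neighbour leaf ab)) (s≤s z≤n)) 1≤b

  deg-rightLeaf : ∀ {a} → RightLeaf a → deg a ≡ 1
  deg-rightLeaf {a} leaf = begin
    deg a                          ≡⟨ countBelow-false (adjacency a) N (≤-trans p≤p+m p+m≤N) above ⟩
    countBelow (adjacency a) (suc q) + indicator (adjacency a (suc q))
      ≡⟨ cong₂ _+_ (countBelow-false (adjacency a) (suc q) z≤n below) (cong indicator (edge (inj₂ (right refl leaf)))) ⟩
    1 ∎
    where
    open ≡-Reasoning
    above : ∀ b → p ≤ b → b < N → adjacency a b ≡ false
    above b p≤b _ = no-edge λ ab → <⇒≱ (n<1+n (suc q)) (subst (p ≤_) (rightLeaf-neighbour leaf ab) p≤b)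
    below : ∀ b → 0 ≤ b → b < suc q → adjacency a b ≡ false
    below b _ b<e = no-edge λ ab → <-irrefl (rightLeaf-neighbour leaf ab) b<e

  deg-leftEnd : deg 0 ≡ suc m
  deg-leftEnd = begin
    deg 0                                ≡⟨ countBelow-false (adjacency 0) N p+m≤N beyond ⟩
    countBelow (adjacency 0) (p + m)     ≡⟨ countBelow-true (adjacency 0) p m (λ b p≤b b<p+m → edge (inj₁ (left refl (p≤b , b<p+m)))) ⟩
    countBelow (adjacency 0) p + m       ≡⟨ cong (_+ m) (countBelow-false (adjacency 0) p (s≤s (s≤s z≤n)) spineBeyond1) ⟩
    0 + indicator (adjacency 0 0) + indicator (adjacency 0 1) + m
      ≡⟨ cong₂ (λ s t → 0 + indicator s + indicator t + m) (adjacency-irrefl 0) (edge (inj₁ (spine refl (s≤s (s≤s z≤n))))) ⟩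
    suc m ∎
    where
    open ≡-Reasoning
    beyond : ∀ b → p + m ≤ b → b < N → adjacency 0 b ≡ false
    beyond b p+m≤b _ = no-edge λ ab → [ (λ { refl → <⇒≱ (s≤s (s≤s z≤n)) (≤-trans p≤p+m p+m≤b) }) , (λ leaf → <⇒≱ (proj₂ leaf) p+m≤b) ] (leftEnd-neighbour ab)
    spineBeyond1 : ∀ b → 2 ≤ b → b < p → adjacency 0 b ≡ false
    spineBeyond1 b 2≤b b<p = no-edge λ ab → [ (λ { refl → <⇒≱ (s≤s z≤n) (≤-pred 2≤b) }) , (λ leaf → <⇒≱ b<p (proj₁ leaf)) ] (leftEnd-neighbour ab)

  deg-rightEnd : deg (suc q) ≡ suc n
  deg-rightEnd = begin
    deg (suc q)
      ≡⟨ countBelow-true (adjacency (suc q)) (p + m) n (λ b p+m≤b b<N → edge (inj₁ (right refl (p+m≤b , b<N)))) ⟩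
    countBelow (adjacency (suc q)) (p + m) + n
      ≡⟨ cong (_+ n) (countBelow-false (adjacency (suc q)) (p + m) p≤p+m leftLeaves) ⟩
    countBelow (adjacency (suc q)) q + indicator (adjacency (suc q) q) + indicator (adjacency (suc q) (suc q)) + n
      ≡⟨ cong (λ r → r + indicator (adjacency (suc q) q) + indicator (adjacency (suc q) (suc q)) + n)
              (countBelow-false (adjacency (suc q)) q z≤n below) ⟩
    indicator (adjacency (suc q) q) + indicator (adjacency (suc q) (suc q)) + n
      ≡⟨ cong₂ (λ s t → indicator s + indicator t + n) (edge (inj₂ (spine refl (n<1+n (suc q))))) (adjacency-irrefl (suc q)) ⟩
    suc n ∎
    where
    open ≡-Reasoning
    leftLeaves : ∀ b → p ≤ b → b < p + m → adjacency (suc q) b ≡ false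
    leftLeaves b p≤b b<p+m = no-edge λ ab →
      [ (λ { refl → <⇒≱ (m<n⇒m<1+n (n<1+n q)) p≤b }) , (λ leaf → <⇒≱ b<p+m (proj₁ leaf)) ] (rightEnd-neighbour ab)
    below : ∀ b → 0 ≤ b → b < q → adjacency (suc q) b ≡ false
    below b _ b<q = no-edge λ ab →
      [ (λ { refl → <-irrefl refl b<q }) , (λ leaf → <⇒≱ (<-trans b<q (<-trans (n<1+n q) (n<1+n (suc q)))) (≤-trans p≤p+m (proj₁ leaf))) ]
      (rightEnd-neighbour ab)

  deg-interior : ∀ {i} → i < q → deg (suc i) ≡ 2
  deg-interior {i} i<q = begin
    deg (suc i)
      ≡⟨ countBelow-false (adjacency (suc i)) N 3+i≤N above ⟩
    countBelow (adjacency (suc i)) i + indicator (adjacency (suc i) i) + indicator (adjacency (suc i) (suc i))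
      + indicator (adjacency (suc i) (suc (suc i)))
      ≡⟨ cong₂ (λ r s → r + indicator s + indicator (adjacency (suc i) (suc i)) + indicator (adjacency (suc i) (suc (suc i))))
               (countBelow-false (adjacency (suc i)) i z≤n below) (edge (inj₂ (spine refl (s≤s (m<n⇒m<1+n i<q))))) ⟩
    1 + indicator (adjacency (suc i) (suc i)) + indicator (adjacency (suc i) (suc (suc i)))
      ≡⟨ cong (λ t → 1 + indicator t + indicator (adjacency (suc i) (suc (suc i)))) (adjacency-irrefl (suc i)) ⟩
    1 + 0 + indicator (adjacency (suc i) (suc (suc i)))
      ≡⟨ cong (λ t → 1 + 0 + indicator t) (edge (inj₁ (spine refl (s≤s (s≤s i<q))))) ⟩
    2 ∎
    where
    open ≡-Reasoning
    3+i≤N : 3 + i ≤ N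
    3+i≤N = ≤-trans (s≤s (s≤s i<q)) (≤-trans p≤p+m p+m≤N)
    above : ∀ b → 3 + i ≤ b → b < N → adjacency (suc i) b ≡ false
    above b 3+i≤b _ = adjacency-false (suc i) b λ ab →
      [ (λ { refl → <⇒≱ (m<n⇒m<1+n (m<n⇒m<1+n (n<1+n i))) 3+i≤b }) , (λ { refl → <-irrefl refl 3+i≤b }) ] (interior-neighbour i<q ab)
    below : ∀ b → 0 ≤ b → b < i → adjacency (suc i) b ≡ false
    below b _ b<i = adjacency-false (suc i) b λ ab →
      [ (λ { refl → <-irrefl refl b<i }) , (λ { refl → <⇒≱ b<i (≤-trans (n≤1+n i) (n≤1+n (suc i))) }) ] (interior-neighbour i<q ab)

  data Position (a : ℕ) : Set where
    leftEnd   : a ≡ 0 → Position a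
    interior  : ∀ i → a ≡ suc i → i < q → Position a
    rightEnd  : a ≡ suc q → Position a
    leftLeaf  : LeftLeaf a → Position a
    rightLeaf : RightLeaf a → Position a

  position : ∀ a → a < N → Position a
  position zero    _   = leftEnd refl
  position (suc i) a<N with <-cmp i q
  ... | tri< i<q _ _ = interior i refl i<q
  ... | tri≈ _ refl _ = rightEnd refl
  ... | tri> _ _ q<i with suc i <? p + m
  ...   | yes a<p+m = leftLeaf (s≤s q<i , a<p+m)
  ...   | no a≮p+m  = rightLeaf (≮⇒≥ a≮p+m , a<N)

module BroomGraph (m n q : ℕ) (1≤m : 1 ≤ m) (1≤n : 1 ≤ n) where
  open DoubleBroomStructure m n q public

  G : Graph
  G = DoubleBroom m n p

  simple : SimpleGraph G
  simple = (λ x y → adjacency-sym (toℕ x) (toℕ y)) , (λ x → adjacency-irrefl (toℕ x))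

  vdeg≡deg : ∀ x → vdeg G x ≡ deg (toℕ x)
  vdeg≡deg x = trans (vdeg≡countFin G x) (countFin-toℕ N (adjacency (toℕ x)))

  adjacent : ∀ {x y : Fin N} → adj G x y ≡ true → Adjacent (toℕ x) (toℕ y)
  adjacent = adjacency-sound _ _

  deg-position : ∀ {a} → Position a → 1 ≤ deg a
  deg-position (leftEnd refl)     = subst (1 ≤_) (sym deg-leftEnd) (s≤s z≤n)
  deg-position (interior _ refl i<q) = subst (1 ≤_) (sym (deg-interior i<q)) (s≤s z≤n)
  deg-position (rightEnd refl)    = subst (1 ≤_) (sym deg-rightEnd) (s≤s z≤n)
  deg-position (leftLeaf leaf)    = subst (1 ≤_) (sym (deg-leftLeaf leaf)) ≤-refl
  deg-position (rightLeaf leaf)   = subst (1 ≤_) (sym (deg-rightLeaf leaf)) ≤-refl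

  deg-spine : ∀ {a} → a < p → 2 ≤ deg a
  deg-spine {zero} _ = subst (2 ≤_) (sym deg-leftEnd) (s≤s 1≤m)
  deg-spine {suc i} 1+i<p with position (suc i) (<-≤-trans 1+i<p (≤-trans p≤p+m p+m≤N))
  ... | interior _ refl i<q = subst (2 ≤_) (sym (deg-interior i<q)) ≤-refl
  ... | rightEnd refl = subst (2 ≤_) (sym deg-rightEnd) (s≤s 1≤n)
  ... | leftEnd ()
  ... | leftLeaf (p≤a , _) = ⊥-elim (<⇒≱ 1+i<p p≤a)
  ... | rightLeaf (p+m≤a , _) = ⊥-elim (<⇒≱ 1+i<p (≤-trans p≤p+m p+m≤a))

  spine-not-leaf : ∀ w → toℕ w < p → ¬ vdeg G w ≡ 1
  spine-not-leaf w w<p deg≡1 = <⇒≱ (deg-spine w<p) (≤-reflexive (trans (sym (vdeg≡deg w)) deg≡1))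

  data LeafArc (c ℓ : ℕ) : Set where
    leftArc  : c ≡ 0 → LeftLeaf ℓ → LeafArc c ℓ
    rightArc : c ≡ suc q → RightLeaf ℓ → LeafArc c ℓ

  leafArc : (e : Edge G) → LeafEdge G e → LeafArc (toℕ (u e)) (toℕ (v e))
  leafArc e leaf with Adjacent⇒Arc (u<v e) (adjacent (isAdj e))
  ... | left c≡0 ℓ-leaf  = leftArc c≡0 ℓ-leaf
  ... | right c≡e ℓ-leaf = rightArc c≡e ℓ-leaf
  ... | spine 1+u≡v v<p with leaf
  ...   | inj₁ deg-u≡1 = ⊥-elim (spine-not-leaf (u e) (<-trans (n<1+n _) (subst (_< p) (sym 1+u≡v) v<p)) deg-u≡1)
  ...   | inj₂ deg-v≡1 = ⊥-elim (spine-not-leaf (v e) v<p deg-v≡1)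

  record MiddleArc (a b : ℕ) : Set where
    field
      step  : suc a ≡ b
      b<p   : b < p
      deg-a : deg a ≡ 2
      deg-b : deg b ≡ 2

  middleArc : (e : Edge G) → MiddleEdge G e → MiddleArc (toℕ (u e)) (toℕ (v e))
  middleArc e (edeg≡2 , _ , v-not-leaf) with Adjacent⇒Arc (u<v e) (adjacent (isAdj e))
  ... | left _ leaf  = ⊥-elim (v-not-leaf (trans (vdeg≡deg (v e)) (deg-leftLeaf leaf)))
  ... | right _ leaf = ⊥-elim (v-not-leaf (trans (vdeg≡deg (v e)) (deg-rightLeaf leaf)))
  ... | spine 1+u≡v v<p = record { step = 1+u≡v ; b<p = v<p ; deg-a = proj₁ both ; deg-b = proj₂ both }
    where
    sum≡4 : deg (toℕ (u e)) + deg (toℕ (v e)) ≡ 4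
    sum≡4 = begin
      deg (toℕ (u e)) + deg (toℕ (v e)) ≡⟨ cong₂ _+_ (vdeg≡deg (u e)) (vdeg≡deg (v e)) ⟨
      vdeg G (u e) + vdeg G (v e)       ≡⟨ edeg+2≡vdeg+vdeg G simple e ⟨
      edeg G e + 2                      ≡⟨ cong (_+ 2) edeg≡2 ⟩
      4 ∎
      where open ≡-Reasoning
    both = both-two sum≡4 (deg-spine (<-trans (n<1+n _) (subst (_< p) (sym 1+u≡v) v<p))) (deg-spine v<p)

  middle-not-leftEnd : ∀ {a b} → 2 ≤ m → MiddleArc a b → 1 ≤ a
  middle-not-leftEnd {zero} 2≤m arc = ⊥-elim (<⇒≱ (s≤s 2≤m) (≤-reflexive (trans (sym deg-leftEnd) (MiddleArc.deg-a arc))))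
  middle-not-leftEnd {suc a} _ _ = s≤s z≤n

  middle-not-rightEnd : ∀ {a b} → 2 ≤ n → MiddleArc a b → b < suc q
  middle-not-rightEnd 2≤n arc with m≤n⇒m<n∨m≡n (≤-pred (MiddleArc.b<p arc))
  ... | inj₁ b<1+q = b<1+q
  ... | inj₂ refl = ⊥-elim (<⇒≱ (s≤s 2≤n) (≤-reflexive (trans (sym deg-rightEnd) (MiddleArc.deg-b arc))))

  middle-interior : ∀ {a b} → 2 ≤ m → 2 ≤ n → MiddleArc a b → Σ ℕ λ i → a ≡ suc i × suc (suc i) ≤ q
  middle-interior {suc i} 2≤m 2≤n arc =
    i , refl , ≤-pred (subst (_< suc q) (sym (MiddleArc.step arc)) (middle-not-rightEnd 2≤n arc))
  middle-interior {zero} 2≤m 2≤n arc = ⊥-elim (<⇒≱ (middle-not-leftEnd 2≤m arc) z≤n)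

  deleteMiddle-no-isolated : (e : Edge G) → MiddleEdge G e → ∀ w → 1 ≤ vdeg (deleteEdge G e) w
  deleteMiddle-no-isolated e middle w with w ≟ᶠ u e | w ≟ᶠ v e
  ... | yes refl | _ = ≤-reflexive (sym (suc-injective (begin
    suc (vdeg (deleteEdge G e) w) ≡⟨ vdeg-deletePair-endpoint G (edge≢ e) (isAdj e) ⟨
    vdeg G w                      ≡⟨ vdeg≡deg w ⟩
    deg (toℕ w)                   ≡⟨ MiddleArc.deg-a (middleArc e middle) ⟩
    2 ∎)))
    where open ≡-Reasoning
  ... | no _ | yes refl = ≤-reflexive (sym (suc-injective (begin
    suc (vdeg (deleteEdge G e) w) ≡⟨ vdeg-deleteEdge-v G simple e ⟨
    vdeg G w                      ≡⟨ vdeg≡deg w ⟩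
    deg (toℕ w)                   ≡⟨ MiddleArc.deg-b (middleArc e middle) ⟩
    2 ∎)))
    where open ≡-Reasoning
  ... | no w≢u | no w≢v =
    subst (1 ≤_) (sym (trans (vdeg-deletePair-other G w≢u w≢v) (vdeg≡deg w))) (deg-position (position (toℕ w) (toℕ<n w)))

  deg-two : ∀ {a} → a < N → deg a ≡ 2 → (Σ ℕ λ i → a ≡ suc i × i < q) ⊎ (a ≡ 0 × m ≡ 1) ⊎ (a ≡ suc q × n ≡ 1)
  deg-two {a} a<N deg≡2 with position a a<N
  ... | leftEnd refl       = inj₂ (inj₁ (refl , suc-injective (trans (sym deg-leftEnd) deg≡2)))
  ... | interior i refl i<q = inj₁ (i , refl , i<q)
  ... | rightEnd refl      = inj₂ (inj₂ (refl , suc-injective (trans (sym deg-rightEnd) deg≡2)))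
  ... | leftLeaf leaf      = case trans (sym (deg-leftLeaf leaf)) deg≡2 of λ ()
  ... | rightLeaf leaf     = case trans (sym (deg-rightLeaf leaf)) deg≡2 of λ ()

  leaf-neighbour : ∀ {a b} → a < N → deg a ≡ 1 → Adjacent a b → b ≡ 0 ⊎ b ≡ suc q
  leaf-neighbour a<N deg≡1 ab with position _ a<N
  ... | leftLeaf leaf  = inj₁ (leftLeaf-neighbour leaf ab)
  ... | rightLeaf leaf = inj₂ (rightLeaf-neighbour leaf ab)
  ... | leftEnd refl   = ⊥-elim (<⇒≱ (s≤s 1≤m) (≤-reflexive (trans (sym deg-leftEnd) deg≡1)))
  ... | rightEnd refl  = ⊥-elim (<⇒≱ (s≤s 1≤n) (≤-reflexive (trans (sym deg-rightEnd) deg≡1)))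
  ... | interior _ refl i<q = case trans (sym (deg-interior i<q)) deg≡1 of λ ()

  -- Once a middle edge is removed, every vertex of degree one is a leaf or an end of that edge, and
  -- none of these is adjacent to another: leaves hang off the two centres, which keep degree ≥ 3.
  deleteMiddle-no-isolatedEdge : 2 ≤ m → 2 ≤ n → (e : Edge G) → MiddleEdge G e → ¬ IsolatedEdge (deleteEdge G e)
  deleteMiddle-no-isolatedEdge 2≤m 2≤n e middle (s , t , st , deg-s , deg-t) =
    pendant (classify s deg-s) (classify t deg-t) (adjacent (proj₁ (∧≡true st))) deg-s deg-t
      (λ same → case trans (sym (proj₂ (∧≡true st))) (cong not same) of λ ())
    where
    arc = middleArc e middle
    interior-edge = middle-interior 2≤m 2≤n arc
    i = proj₁ interior-edge
    u≡ : toℕ (u e) ≡ suc i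
    u≡ = proj₁ (proj₂ interior-edge)
    v≡ : toℕ (v e) ≡ suc (suc i)
    v≡ = trans (sym (MiddleArc.step arc)) (cong suc u≡)
    2+i≤q = proj₂ (proj₂ interior-edge)

    endpoint-not-centre : ∀ {w} → w ≡ u e ⊎ w ≡ v e → ¬ (toℕ w ≡ 0 ⊎ toℕ w ≡ suc q)
    endpoint-not-centre (inj₁ refl) (inj₁ w≡0) = case trans (sym u≡) w≡0 of λ ()
    endpoint-not-centre (inj₁ refl) (inj₂ w≡e) = <-irrefl (trans (sym u≡) w≡e) (s≤s (≤-trans (n≤1+n _) 2+i≤q))
    endpoint-not-centre (inj₂ refl) (inj₁ w≡0) = case trans (sym v≡) w≡0 of λ ()
    endpoint-not-centre (inj₂ refl) (inj₂ w≡e) = <-irrefl (trans (sym v≡) w≡e) (s≤s 2+i≤q)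

    centre-deg : ∀ {w} → toℕ w ≡ 0 ⊎ toℕ w ≡ suc q → 3 ≤ deg (toℕ w)
    centre-deg (inj₁ w≡0) = subst (3 ≤_) (sym (trans (cong deg w≡0) deg-leftEnd)) (s≤s 2≤m)
    centre-deg (inj₂ w≡e) = subst (3 ≤_) (sym (trans (cong deg w≡e) deg-rightEnd)) (s≤s 2≤n)

    classify : ∀ w → vdeg (deleteEdge G e) w ≡ 1 → (w ≡ u e ⊎ w ≡ v e) ⊎ deg (toℕ w) ≡ 1
    classify w deg≡1 with w ≟ᶠ u e | w ≟ᶠ v e
    ... | yes w≡u | _       = inj₁ (inj₁ w≡u)
    ... | no _    | yes w≡v = inj₁ (inj₂ w≡v)
    ... | no w≢u  | no w≢v  = inj₂ (trans (sym (trans (vdeg-deletePair-other G w≢u w≢v) (vdeg≡deg w))) deg≡1)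

    leaf-next-to : ∀ {w y} → deg (toℕ w) ≡ 1 → Adjacent (toℕ w) (toℕ y) → ¬ vdeg (deleteEdge G e) y ≡ 1
    leaf-next-to {w} {y} deg-w wy deg-y with leaf-neighbour (toℕ<n w) deg-w wy | classify y deg-y
    ... | centre | inj₁ y∈e    = endpoint-not-centre y∈e centre
    ... | centre | inj₂ deg-y≡1 = case ≤-trans (centre-deg centre) (≤-reflexive deg-y≡1) of λ { (s≤s ()) }

    pendant : ∀ {s t} → (s ≡ u e ⊎ s ≡ v e) ⊎ deg (toℕ s) ≡ 1 → (t ≡ u e ⊎ t ≡ v e) ⊎ deg (toℕ t) ≡ 1 →
              Adjacent (toℕ s) (toℕ t) → vdeg (deleteEdge G e) s ≡ 1 → vdeg (deleteEdge G e) t ≡ 1 →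
              ¬ samePair (u e) (v e) s t ≡ true → ⊥
    pendant (inj₂ deg-s) _ st _ deg-t _ = leaf-next-to deg-s st deg-t
    pendant (inj₁ _) (inj₂ deg-t) st deg-s _ _ = leaf-next-to deg-t (swap st) deg-s
    pendant (inj₁ (inj₁ refl)) (inj₁ (inj₁ refl)) st _ _ _ = Adjacent-irrefl _ st
    pendant (inj₁ (inj₂ refl)) (inj₁ (inj₂ refl)) st _ _ _ = Adjacent-irrefl _ st
    pendant (inj₁ (inj₁ refl)) (inj₁ (inj₂ refl)) _ _ _ other = other (samePair-self (u e) (v e))
    pendant (inj₁ (inj₂ refl)) (inj₁ (inj₁ refl)) _ _ _ other =
      other (trans (samePair-flip (u e) (v e) (v e) (u e)) (samePair-self (u e) (v e)))

  another-between : ∀ lo hi → 2 + lo ≤ hi → hi ≤ N → ∀ L → Σ (Fin N) λ w → (lo ≤ toℕ w × toℕ w < hi) × ¬ toℕ w ≡ L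
  another-between lo hi 2+lo≤hi hi≤N L with lo ≟ L
  ... | no lo≢L = fromℕ< lo<N , subst (λ j → lo ≤ j × j < hi) (sym toℕ-lo) (≤-refl , lo<hi) , lo≢L ∘ trans (sym toℕ-lo)
    where
    lo<hi = ≤-trans (n≤1+n _) 2+lo≤hi
    lo<N = <-≤-trans lo<hi hi≤N
    toℕ-lo = toℕ-fromℕ< lo<N
  ... | yes refl = fromℕ< 1+lo<N , subst (λ j → lo ≤ j × j < hi) (sym toℕ-1+lo) (n≤1+n lo , 2+lo≤hi) ,
                   (λ 1+lo≡lo → 1+n≢n (trans (sym toℕ-1+lo) 1+lo≡lo))
    where
    1+lo<N = <-≤-trans 2+lo≤hi hi≤N
    toℕ-1+lo = toℕ-fromℕ< 1+lo<N

  Reattachedℕ : ℕ → ℕ → ℕ → ℕ → ℕ → Set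
  Reattachedℕ C L X s t = (Adjacent s t × ¬ PairOf C L s t) ⊎ PairOf L X s t

  Reattachedℕ-swap : ∀ {C L X s t} → Reattachedℕ C L X s t → Reattachedℕ C L X t s
  Reattachedℕ-swap (inj₁ (st , not-removed)) = inj₁ (swap st , not-removed ∘ PairOf-swap)
  Reattachedℕ-swap (inj₂ new) = inj₂ (PairOf-swap new)

  unique-leftLeaf : m ≡ 1 → ∀ {a} → LeftLeaf a → a ≡ p
  unique-leftLeaf refl {a} (p≤a , a<p+1) = ≤-antisym (≤-pred (subst (a <_) (+-comm p 1) a<p+1)) p≤a

  unique-rightLeaf : n ≡ 1 → ∀ {a} → RightLeaf a → a ≡ p + m
  unique-rightLeaf refl {a} (p+m≤a , a<N) = ≤-antisym (≤-pred (subst (a <_) (+-comm (p + m) 1) a<N)) p+m≤a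

  middle-needs-spine : ∀ {a b} → 2 ≤ m → 2 ≤ n → MiddleArc a b → 2 ≤ q
  middle-needs-spine 2≤m 2≤n arc with middle-interior 2≤m 2≤n arc
  ... | _ , _ , 2+i≤q = ≤-trans (s≤s (s≤s z≤n)) 2+i≤q

  middle-needs-interior : ∀ {a b} → 2 ≤ n → MiddleArc a b → 1 ≤ q
  middle-needs-interior 2≤n arc = ≤-trans (s≤s z≤n) (≤-pred (subst (_< suc q) (sym (MiddleArc.step arc)) (middle-not-rightEnd 2≤n arc)))

  leafEdge-leaf : (e : Edge G) → LeafEdge G e → vdeg G (v e) ≡ 1
  leafEdge-leaf e leafEdge with leafArc e leafEdge
  ... | leftArc _ leaf  = trans (vdeg≡deg (v e)) (deg-leftLeaf leaf)
  ... | rightArc _ leaf = trans (vdeg≡deg (v e)) (deg-rightLeaf leaf)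

  module Reattached {e₁ e₂ : Edge G} (leafEdge : LeafEdge G e₁) (middle : MiddleEdge G e₂)
           (r : LeafReattachment G e₁ e₂) where
    open LeafReattachment r

    c ℓ : Fin N
    c = u e₁
    ℓ = v e₁

    G₁ G″ : Graph
    G₁ = deleteEdge G e₁
    G″ = reattachLeaf G e₁ x

    G″-sym : Symmetric G″
    G″-sym = addPair-symmetric G₁ ℓ x (deletePair-symmetric G c ℓ (proj₁ simple))

    arc₁ : LeafArc (toℕ c) (toℕ ℓ)
    arc₁ = leafArc e₁ leafEdge

    arc₂ : MiddleArc (toℕ (u e₂)) (toℕ (v e₂))
    arc₂ = middleArc e₂ middle

    vdeg-ℓ : vdeg G ℓ ≡ 1
    vdeg-ℓ = leafEdge-leaf e₁ leafEdge

    vdeg-G₁-other : ∀ {w} → ¬ w ≡ c → ¬ w ≡ ℓ → vdeg G₁ w ≡ deg (toℕ w)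
    vdeg-G₁-other {w} w≢c w≢ℓ = trans (vdeg-deletePair-other G w≢c w≢ℓ) (vdeg≡deg w)

    vdeg-G″-other : ∀ {w} → ¬ w ≡ ℓ → ¬ w ≡ x → vdeg G″ w ≡ vdeg G₁ w
    vdeg-G″-other = vdeg-addPair-other G₁

    vdeg-G″-ℓ : vdeg G″ ℓ ≡ 1
    vdeg-G″-ℓ = vdeg-reattachLeaf-leaf G simple e₁ vdeg-ℓ leaf≢x

    vdeg-G″-x : vdeg G″ x ≡ suc (vdeg G₁ x)
    vdeg-G″-x = vdeg-reattachLeaf-target G simple e₁ vdeg-ℓ leaf≢x

    vdeg-G″-c : ¬ x ≡ c → suc (vdeg G″ c) ≡ deg (toℕ c)
    vdeg-G″-c x≢c = begin
      suc (vdeg G″ c) ≡⟨ cong suc (vdeg-G″-other (edge≢ e₁) (x≢c ∘ sym)) ⟩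
      suc (vdeg G₁ c) ≡⟨ vdeg-deletePair-endpoint G (edge≢ e₁) (isAdj e₁) ⟨
      vdeg G c        ≡⟨ vdeg≡deg c ⟩
      deg (toℕ c) ∎
      where open ≡-Reasoning

    deg-target : ¬ x ≡ c → suc (deg (toℕ x)) ≡ deg (toℕ c)
    deg-target x≢c = suc-injective (begin
      suc (suc (deg (toℕ x)))     ≡⟨ cong (2 +_) (vdeg-G₁-other x≢c (leaf≢x ∘ sym)) ⟨
      suc (suc (vdeg G₁ x))       ≡⟨ degree-balance ⟩
      vdeg G c + vdeg G ℓ         ≡⟨ cong₂ _+_ (vdeg≡deg c) vdeg-ℓ ⟩
      deg (toℕ c) + 1             ≡⟨ +-comm (deg (toℕ c)) 1 ⟩
      suc (deg (toℕ c)) ∎)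
      where open ≡-Reasoning

    degree-two-in-G″ : ¬ x ≡ c → ∀ w → vdeg G″ w ≡ 2 →
      (w ≡ x × deg (toℕ x) ≡ 1) ⊎ (w ≡ c × deg (toℕ c) ≡ 3) ⊎
      (¬ w ≡ x × ¬ w ≡ c × deg (toℕ w) ≡ 2)
    degree-two-in-G″ x≢c w vdeg≡2 with w ≟ᶠ x | w ≟ᶠ ℓ | w ≟ᶠ c
    ... | yes refl | _ | _ =
      inj₁ (refl , suc-injective (trans (cong suc (sym (vdeg-G₁-other x≢c (leaf≢x ∘ sym)))) (trans (sym vdeg-G″-x) vdeg≡2)))
    ... | no _ | yes refl | _ = case trans (sym vdeg-G″-ℓ) vdeg≡2 of λ ()
    ... | no _ | no _ | yes refl = inj₂ (inj₁ (refl , trans (sym (vdeg-G″-c x≢c)) (cong suc vdeg≡2)))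
    ... | no w≢x | no w≢ℓ | no w≢c =
      inj₂ (inj₂ (w≢x , w≢c , trans (sym (vdeg-G₁-other w≢c w≢ℓ)) (trans (sym (vdeg-G″-other w≢ℓ w≢x)) vdeg≡2)))

    a≢ℓ : ¬ a ≡ ℓ
    a≢ℓ refl = case trans (sym vdeg-G″-ℓ) vdeg-a of λ ()

    b≢ℓ : ¬ b ≡ ℓ
    b≢ℓ refl = case trans (sym vdeg-G″-ℓ) vdeg-b of λ ()

    ab-adjacent : Adjacent (toℕ a) (toℕ b)
    ab-adjacent with samePair ℓ x a b in ab-new
    ... | true with samePair⇒ ℓ x a b ab-new
    ...   | inj₁ (a≡ℓ , _) = ⊥-elim (a≢ℓ a≡ℓ)
    ...   | inj₂ (_ , b≡ℓ) = ⊥-elim (b≢ℓ b≡ℓ)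
    ab-adjacent | false with adj G a b in ab-old
    ... | true  = adjacent ab-old
    ... | false = case trans (sym ab-edge) (cong₂ (λ s t → (s ∧ not (samePair c ℓ a b)) ∨ t) ab-old ab-new) of λ ()

    two-candidates : ∀ {A B} → (∀ w → vdeg G″ w ≡ 2 → toℕ w ≡ A ⊎ toℕ w ≡ B) → Adjacent A B
    two-candidates candidate with candidate a vdeg-a | candidate b vdeg-b
    ... | inj₁ a≡A | inj₂ b≡B = subst₂ Adjacent a≡A b≡B ab-adjacent
    ... | inj₂ a≡B | inj₁ b≡A = swap (subst₂ Adjacent a≡B b≡A ab-adjacent)
    ... | inj₁ a≡A | inj₁ b≡A = ⊥-elim (a≢b (toℕ-injective (trans a≡A (sym b≡A))))
    ... | inj₂ a≡B | inj₂ b≡B = ⊥-elim (a≢b (toℕ-injective (trans a≡B (sym b≡B))))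

    vdeg-deleted-a : vdeg (deletePair G″ a b) a ≡ 1
    vdeg-deleted-a = suc-injective (trans (sym (vdeg-deletePair-endpoint G″ a≢b ab-edge)) vdeg-a)

    vdeg-deleted-b : vdeg (deletePair G″ a b) b ≡ 1
    vdeg-deleted-b = suc-injective (begin
      suc (vdeg (deletePair G″ a b) b) ≡⟨ cong suc (vdeg-deletePair-comm G″ a b b) ⟩
      suc (vdeg (deletePair G″ b a) b) ≡⟨ vdeg-deletePair-endpoint G″ (a≢b ∘ sym) (trans (G″-sym b a) ab-edge) ⟨
      vdeg G″ b                        ≡⟨ vdeg-b ⟩
      2 ∎)
      where open ≡-Reasoning

    data DegreeTwo (w : Fin N) : Set where
      moved     : w ≡ x → deg (toℕ x) ≡ 1 → DegreeTwo w
      centre    : w ≡ c → deg (toℕ c) ≡ 3 → DegreeTwo w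
      inner     : ¬ w ≡ x → ∀ i → toℕ w ≡ suc i → i < q → DegreeTwo w
      leftEnd₁  : ¬ w ≡ c → toℕ w ≡ 0 → m ≡ 1 → DegreeTwo w
      rightEnd₁ : ¬ w ≡ c → toℕ w ≡ suc q → n ≡ 1 → DegreeTwo w

    degreeTwo : ¬ x ≡ c → ∀ w → vdeg G″ w ≡ 2 → DegreeTwo w
    degreeTwo x≢c w vdeg≡2 with degree-two-in-G″ x≢c w vdeg≡2
    ... | inj₁ (w≡x , deg-x) = moved w≡x deg-x
    ... | inj₂ (inj₁ (w≡c , deg-c)) = centre w≡c deg-c
    ... | inj₂ (inj₂ (w≢x , w≢c , deg-w)) with deg-two (toℕ<n w) deg-w
    ...   | inj₁ (i , w≡1+i , i<q) = inner w≢x i w≡1+i i<q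
    ...   | inj₂ (inj₁ (w≡0 , m≡1)) = leftEnd₁ w≢c w≡0 m≡1
    ...   | inj₂ (inj₂ (w≡e , n≡1)) = rightEnd₁ w≢c w≡e n≡1

    centre-among : ∀ {B} → (∀ w → vdeg G″ w ≡ 2 → toℕ w ≡ toℕ c ⊎ toℕ w ≡ B) → c ≡ a ⊎ c ≡ b
    centre-among candidate with candidate a vdeg-a | candidate b vdeg-b
    ... | inj₁ a≡c | _        = inj₁ (toℕ-injective (sym a≡c))
    ... | inj₂ _   | inj₁ b≡c = inj₂ (toℕ-injective (sym b≡c))
    ... | inj₂ a≡B | inj₂ b≡B = ⊥-elim (a≢b (toℕ-injective (trans a≡B (sym b≡B))))

    -- If c is one of the two degree-2 vertices, deleting ab leaves c with a single neighbour, a second leaf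
    -- of c: an isolated edge, which G - e₂ does not have.
    no-sibling-edge : ∀ {B} → 2 ≤ m → 2 ≤ n → toℕ x < p → toℕ c < p → B < p →
                      (∀ w → vdeg G″ w ≡ 2 → toℕ w ≡ toℕ c ⊎ toℕ w ≡ B) → ⊥
    no-sibling-edge {B} 2≤m 2≤n x<p c<p B<p candidate =
      deleteMiddle-no-isolatedEdge 2≤m 2≤n e₂ middle
        (IsolatedEdge-≅ {deletePair G″ a b} {deleteEdge G e₂} deleted-ab (c , y , cy , vdeg-c′ , vdeg-y′))
      where
      record Sibling : Set where
        field
          y    : Fin N
          c-y  : Arc (toℕ c) (toℕ y)
          p≤y  : p ≤ toℕ y
          deg-y : deg (toℕ y) ≡ 1
          y≢ℓ  : ¬ toℕ y ≡ toℕ ℓ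

      sibling : Sibling
      sibling with arc₁
      ... | leftArc c≡0 _ with another-between p (p + m) (subst (_≤ p + m) (+-comm p 2) (+-monoʳ-≤ p 2≤m)) p+m≤N (toℕ ℓ)
      ...   | y , leaf , y≢ℓ = record { y = y ; c-y = left c≡0 leaf ; p≤y = proj₁ leaf ; deg-y = deg-leftLeaf leaf ; y≢ℓ = y≢ℓ }
      sibling | rightArc c≡e _ with another-between (p + m) N (subst (_≤ N) (+-comm (p + m) 2) (+-monoʳ-≤ (p + m) 2≤n)) ≤-refl (toℕ ℓ)
      ...   | y , leaf , y≢ℓ = record { y = y ; c-y = right c≡e leaf ; p≤y = ≤-trans p≤p+m (proj₁ leaf) ; deg-y = deg-rightLeaf leaf ; y≢ℓ = y≢ℓ }

      open Sibling sibling

      c∈ab = centre-among candidate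

      candidate-< : ∀ w → vdeg G″ w ≡ 2 → toℕ w < p
      candidate-< w deg≡2 = [ (λ w≡c → subst (_< p) (sym w≡c) c<p) , (λ w≡B → subst (_< p) (sym w≡B) B<p) ] (candidate w deg≡2)
      a<p = candidate-< a vdeg-a
      b<p = candidate-< b vdeg-b

      y≢ : ∀ {w} → toℕ w < p → ¬ y ≡ w
      y≢ w<p refl = <⇒≱ w<p p≤y

      cy : adj (deletePair G″ a b) c y ≡ true
      cy rewrite adjacency-complete (toℕ c) (toℕ y) (inj₁ c-y) | samePair-endpoint (edge≢ e₁) y
               | ≢⇒==-false (y≢ℓ ∘ cong toℕ) | samePair-outsideʳ (y≢ a<p) (y≢ b<p) c = refl

      vdeg-c′ : vdeg (deletePair G″ a b) c ≡ 1
      vdeg-c′ = [ (λ c≡a → subst (λ w → vdeg (deletePair G″ a b) w ≡ 1) (sym c≡a) vdeg-deleted-a)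
                , (λ c≡b → subst (λ w → vdeg (deletePair G″ a b) w ≡ 1) (sym c≡b) vdeg-deleted-b) ] c∈ab

      vdeg-y′ : vdeg (deletePair G″ a b) y ≡ 1
      vdeg-y′ = begin
        vdeg (deletePair G″ a b) y ≡⟨ vdeg-deletePair-other G″ (y≢ a<p) (y≢ b<p) ⟩
        vdeg G″ y                  ≡⟨ vdeg-G″-other (y≢ℓ ∘ cong toℕ) (y≢ x<p) ⟩
        vdeg G₁ y                  ≡⟨ vdeg-G₁-other (y≢ c<p) (y≢ℓ ∘ cong toℕ) ⟩
        deg (toℕ y)                ≡⟨ deg-y ⟩
        1 ∎
        where open ≡-Reasoning

    not-adjacent-0-2 : 2 < p → ¬ Adjacent 0 2
    not-adjacent-0-2 2<p adj₀₂ with leftEnd-neighbour adj₀₂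
    ... | inj₂ (p≤2 , _) = <⇒≱ 2<p p≤2

    left-to-inner : m ≡ 2 → q ≡ 2 → 2 ≤ n → ¬ x ≡ c → toℕ c ≡ 0 → ∀ i → toℕ x ≡ suc i → i < 2 → ⊥
    left-to-inner refl refl 2≤n x≢c c≡0 zero x≡1 _ = not-adjacent-0-2 (s≤s (s≤s (s≤s z≤n))) (two-candidates candidate)
      where
      candidate : ∀ w → vdeg G″ w ≡ 2 → toℕ w ≡ 0 ⊎ toℕ w ≡ 2
      candidate w deg≡2 with degreeTwo x≢c w deg≡2
      ... | moved _ deg-x = case trans (sym (trans (cong deg x≡1) (deg-interior (s≤s z≤n)))) deg-x of λ ()
      ... | centre w≡c _ = inj₁ (trans (cong toℕ w≡c) c≡0)
      ... | inner w≢x zero w≡1 _ = ⊥-elim (w≢x (toℕ-injective (trans w≡1 (sym x≡1))))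
      ... | inner _ (suc zero) w≡2 _ = inj₂ w≡2
      ... | inner _ (suc (suc _)) _ (s≤s (s≤s ()))
      ... | leftEnd₁ _ _ ()
      ... | rightEnd₁ _ _ refl = case 2≤n of λ { (s≤s ()) }
    left-to-inner refl refl 2≤n x≢c c≡0 (suc zero) x≡2 _ =
      no-sibling-edge ≤-refl 2≤n (subst (_< 4) (sym x≡2) (s≤s (s≤s (s≤s z≤n)))) (subst (_< 4) (sym c≡0) (s≤s z≤n))
        (s≤s (s≤s z≤n)) candidate
      where
      candidate : ∀ w → vdeg G″ w ≡ 2 → toℕ w ≡ toℕ c ⊎ toℕ w ≡ 1
      candidate w deg≡2 with degreeTwo x≢c w deg≡2
      ... | moved _ deg-x = case trans (sym (trans (cong deg x≡2) (deg-interior (s≤s (s≤s z≤n))))) deg-x of λ ()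
      ... | centre w≡c _ = inj₁ (cong toℕ w≡c)
      ... | inner _ zero w≡1 _ = inj₂ w≡1
      ... | inner w≢x (suc zero) w≡2 _ = ⊥-elim (w≢x (toℕ-injective (trans w≡2 (sym x≡2))))
      ... | inner _ (suc (suc _)) _ (s≤s (s≤s ()))
      ... | leftEnd₁ _ _ ()
      ... | rightEnd₁ _ _ refl = case 2≤n of λ { (s≤s ()) }

    left-to-inner _ _ _ _ _ (suc (suc _)) _ (s≤s (s≤s ()))

    right-to-inner : m ≡ 2 → n ≡ 2 → q ≡ 2 → ¬ x ≡ c → toℕ c ≡ 3 → ∀ i → toℕ x ≡ suc i → i < 2 → ⊥
    right-to-inner refl refl refl x≢c c≡3 (suc zero) x≡2 _ = not-adjacent-3-1 (two-candidates candidate)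
      where
      candidate : ∀ w → vdeg G″ w ≡ 2 → toℕ w ≡ 3 ⊎ toℕ w ≡ 1
      candidate w deg≡2 with degreeTwo x≢c w deg≡2
      ... | moved _ deg-x = case trans (sym (trans (cong deg x≡2) (deg-interior (s≤s (s≤s z≤n))))) deg-x of λ ()
      ... | centre w≡c _ = inj₁ (trans (cong toℕ w≡c) c≡3)
      ... | inner _ zero w≡1 _ = inj₂ w≡1
      ... | inner w≢x (suc zero) w≡2 _ = ⊥-elim (w≢x (toℕ-injective (trans w≡2 (sym x≡2))))
      ... | inner _ (suc (suc _)) _ (s≤s (s≤s ()))
      ... | leftEnd₁ _ _ ()
      ... | rightEnd₁ _ _ ()
      not-adjacent-3-1 : ¬ Adjacent 3 1
      not-adjacent-3-1 adj₃₁ with rightEnd-neighbour adj₃₁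
      ... | inj₂ (p+m≤1 , _) = case p+m≤1 of λ { (s≤s ()) }
    right-to-inner refl refl refl x≢c c≡3 zero x≡1 _ =
      no-sibling-edge ≤-refl ≤-refl (subst (_< 4) (sym x≡1) (s≤s (s≤s z≤n))) (subst (_< 4) (sym c≡3) ≤-refl)
        (s≤s (s≤s (s≤s z≤n))) candidate
      where
      candidate : ∀ w → vdeg G″ w ≡ 2 → toℕ w ≡ toℕ c ⊎ toℕ w ≡ 2
      candidate w deg≡2 with degreeTwo x≢c w deg≡2
      ... | moved _ deg-x = case trans (sym (trans (cong deg x≡1) (deg-interior (s≤s z≤n)))) deg-x of λ ()
      ... | centre w≡c _ = inj₁ (cong toℕ w≡c)
      ... | inner w≢x zero w≡1 _ = ⊥-elim (w≢x (toℕ-injective (trans w≡1 (sym x≡1))))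
      ... | inner _ (suc zero) w≡2 _ = inj₂ w≡2
      ... | inner _ (suc (suc _)) _ (s≤s (s≤s ()))
      ... | leftEnd₁ _ _ ()
      ... | rightEnd₁ _ _ ()

    right-to-inner _ _ _ _ _ (suc (suc _)) _ (s≤s (s≤s ()))

    left-to-rightLeaf : m ≡ 1 → q ≡ 1 → 2 ≤ n → ¬ x ≡ c → toℕ c ≡ 0 → RightLeaf (toℕ x) → ⊥
    left-to-rightLeaf refl refl 2≤n x≢c c≡0 x-leaf =
      case rightLeaf-neighbour x-leaf (two-candidates candidate) of λ ()
      where
      candidate : ∀ w → vdeg G″ w ≡ 2 → toℕ w ≡ toℕ x ⊎ toℕ w ≡ 1
      candidate w deg≡2 with degreeTwo x≢c w deg≡2
      ... | moved w≡x _ = inj₁ (cong toℕ w≡x)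
      ... | centre _ deg-c = case trans (sym (trans (cong deg c≡0) deg-leftEnd)) deg-c of λ ()
      ... | inner _ zero w≡1 _ = inj₂ w≡1
      ... | inner _ (suc _) _ (s≤s ())
      ... | leftEnd₁ w≢c w≡0 _ = ⊥-elim (w≢c (toℕ-injective (trans w≡0 (sym c≡0))))
      ... | rightEnd₁ _ _ refl = case 2≤n of λ { (s≤s ()) }

    right-to-inner₁ : m ≡ 1 → n ≡ 2 → q ≡ 1 → ¬ x ≡ c → toℕ c ≡ 2 → toℕ x ≡ 1 → ⊥
    right-to-inner₁ refl refl refl x≢c c≡2 x≡1 = not-adjacent-0-2 ≤-refl (swap (two-candidates candidate))
      where
      candidate : ∀ w → vdeg G″ w ≡ 2 → toℕ w ≡ 2 ⊎ toℕ w ≡ 0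
      candidate w deg≡2 with degreeTwo x≢c w deg≡2
      ... | moved _ deg-x = case trans (sym (trans (cong deg x≡1) (deg-interior (s≤s z≤n)))) deg-x of λ ()
      ... | centre w≡c _ = inj₁ (trans (cong toℕ w≡c) c≡2)
      ... | inner w≢x zero w≡1 _ = ⊥-elim (w≢x (toℕ-injective (trans w≡1 (sym x≡1))))
      ... | inner _ (suc _) _ (s≤s ())
      ... | leftEnd₁ _ w≡0 _ = inj₂ w≡0
      ... | rightEnd₁ w≢c w≡2 _ = ⊥-elim (w≢c (toℕ-injective (trans w≡2 (sym c≡2))))

    reattached-sound : ∀ s t → adj G″ s t ≡ true → Reattachedℕ (toℕ c) (toℕ ℓ) (toℕ x) (toℕ s) (toℕ t)
    reattached-sound s t st with samePair ℓ x s t in new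
    ... | true  = inj₂ (samePair-sound ℓ x s t new)
    ... | false with ∧≡true (trans (sym (∨-identityʳ _)) st)
    ...   | old , not-removed = inj₁ (adjacent old , λ removed →
              case trans (sym not-removed) (cong not (samePair-complete c ℓ s t removed)) of λ ())

    reattached-complete : ∀ s t → Reattachedℕ (toℕ c) (toℕ ℓ) (toℕ x) (toℕ s) (toℕ t) → adj G″ s t ≡ true
    reattached-complete s t (inj₂ new) =
      trans (cong (adj G₁ s t ∨_) (samePair-complete ℓ x s t new)) (∨-zeroʳ (adj G₁ s t))
    reattached-complete s t (inj₁ (old , not-removed)) with samePair c ℓ s t in removed
    ... | true  = ⊥-elim (not-removed (samePair-sound c ℓ s t removed))
    ... | false rewrite adjacency-complete (toℕ s) (toℕ t) old = refl

    -- σ acts on vertex numbers; edges need only be checked as arcs, the reverse orientation following by symmetry.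
    reattached-≅ : ∀ {C L X} → toℕ c ≡ C → toℕ ℓ ≡ L → toℕ x ≡ X →
      (σ : ℕ → ℕ) → (∀ a → a < N → σ a < N) → (∀ a → a < N → σ (σ a) ≡ a) →
      (∀ {s t} → Arc s t → ¬ PairOf C L s t → Adjacent (σ s) (σ t)) →
      Adjacent (σ L) (σ X) →
      (∀ {s t} → Arc s t → Reattachedℕ C L X (σ s) (σ t)) →
      G″ ≅ G
    reattached-≅ {C} {L} {X} c≡C ℓ≡L x≡X σ bound involutive old-arc new-edge arc-back =
      involution-≅ (adj G″) (adj G) τ τ-involutive forward backward
      where
      τ = proj₁ (involution-fromℕ σ bound involutive)
      toℕ-τ = proj₁ (proj₂ (involution-fromℕ σ bound involutive))
      τ-involutive = proj₂ (proj₂ (involution-fromℕ σ bound involutive))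

      to-values : ∀ {s t} → Reattachedℕ (toℕ c) (toℕ ℓ) (toℕ x) s t → Reattachedℕ C L X s t
      to-values = subst₂ (λ C L → Reattachedℕ C L _ _ _) c≡C ℓ≡L ∘ subst (λ X → Reattachedℕ _ _ X _ _) x≡X

      from-values : ∀ {s t} → Reattachedℕ C L X s t → Reattachedℕ (toℕ c) (toℕ ℓ) (toℕ x) s t
      from-values = subst₂ (λ C L → Reattachedℕ C L _ _ _) (sym c≡C) (sym ℓ≡L) ∘ subst (λ X → Reattachedℕ _ _ X _ _) (sym x≡X)

      forward′ : ∀ {s t} → Reattachedℕ C L X s t → Adjacent (σ s) (σ t)
      forward′ (inj₁ (inj₁ arc , not-removed)) = old-arc arc not-removed
      forward′ (inj₁ (inj₂ arc , not-removed)) = swap (old-arc arc (not-removed ∘ PairOf-swap))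
      forward′ (inj₂ (inj₁ (refl , refl))) = new-edge
      forward′ (inj₂ (inj₂ (refl , refl))) = swap new-edge

      forward : ∀ s t → adj G″ s t ≡ true → adj G (τ s) (τ t) ≡ true
      forward s t st = adjacency-complete (toℕ (τ s)) (toℕ (τ t))
        (subst₂ Adjacent (sym (toℕ-τ s)) (sym (toℕ-τ t)) (forward′ (to-values (reattached-sound s t st))))

      backward : ∀ s t → adj G s t ≡ true → adj G″ (τ s) (τ t) ≡ true
      backward s t st = reattached-complete (τ s) (τ t)
        (subst₂ (Reattachedℕ _ _ _) (sym (toℕ-τ s)) (sym (toℕ-τ t)) (from-values (back (adjacent st))))
        where
        back : Adjacent (toℕ s) (toℕ t) → Reattachedℕ C L X (σ (toℕ s)) (σ (toℕ t))
        back (inj₁ arc) = arc-back arc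
        back (inj₂ arc) = Reattachedℕ-swap (arc-back arc)

    -- For m = n = 1 the broom is a path p, 0, 1, …, q+1, p+1; moving p to the far end gives the path
    -- 0, 1, …, q+1, p+1, p, which σ reverses.
    path-left-to-right : m ≡ 1 → n ≡ 1 → toℕ c ≡ 0 → RightLeaf (toℕ x) → G″ ≅ G
    path-left-to-right refl refl c≡0 x-leaf =
      reattached-≅ c≡0 ℓ≡p x≡1+p σ bound involutive old-arc new-edge arc-back
      where
      ℓ≡p : toℕ ℓ ≡ p
      ℓ≡p with arc₁
      ... | leftArc _ leaf = unique-leftLeaf refl leaf
      ... | rightArc c≡e _ = case trans (sym c≡0) c≡e of λ ()
      x≡1+p : toℕ x ≡ suc p
      x≡1+p = trans (unique-rightLeaf refl x-leaf) (+-comm p 1)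
      N≡ : N ≡ suc (suc p)
      N≡ = trans (+-assoc p 1 1) (+-comm p 2)

      σ : ℕ → ℕ
      σ a = if a ≡ᵇ 0 then suc p else if a <ᵇ p then p ∸ a else if a ≡ᵇ p then p else 0

      σ-spine : ∀ {a} → 1 ≤ a → a < p → σ a ≡ p ∸ a
      σ-spine {suc a} _ a<p rewrite <ᵇ-true a<p = refl
      σ-p : σ p ≡ p
      σ-p rewrite <ᵇ-false (<-irrefl {p} refl) | ≡ᵇ-refl p = refl
      σ-1+p : σ (suc p) ≡ 0
      σ-1+p rewrite <ᵇ-false (<-asym (n<1+n p)) | ≡ᵇ-false (1+n≢n {p}) = refl

      data Region (a : ℕ) : Set where
        start  : a ≡ 0 → Region a
        inside : 1 ≤ a → a < p → Region a
        end    : a ≡ p → Region a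
        after  : a ≡ suc p → Region a

      region : ∀ a → a < N → Region a
      region zero _ = start refl
      region (suc a) a<N with suc a <? p | suc a ≟ p
      ... | yes a<p | _ = inside (s≤s z≤n) a<p
      ... | no _ | yes a≡p = end a≡p
      ... | no a≮p | no a≢p = after (≤-antisym (≤-pred (subst (suc a <_) N≡ a<N)) (≤∧≢⇒< (≮⇒≥ a≮p) (a≢p ∘ sym)))

      p∸a<p : ∀ {a} → 1 ≤ a → p ∸ a < p
      p∸a<p {suc a} _ = s≤s (m∸n≤m (suc q) a)
      1≤p∸a : ∀ {a} → a < p → 1 ≤ p ∸ a
      1≤p∸a a<p = subst (1 ≤_) (∸-suc a<p) (s≤s z≤n)
      p<N : p < N
      p<N = subst (p <_) (sym N≡) (<-trans (n<1+n p) (n<1+n (suc p)))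

      bound : ∀ a → a < N → σ a < N
      bound a a<N with region a a<N
      ... | start refl = subst (suc p <_) (sym N≡) (n<1+n (suc p))
      ... | inside 1≤a a<p rewrite σ-spine 1≤a a<p = <-trans (p∸a<p 1≤a) p<N
      ... | end refl rewrite σ-p = p<N
      ... | after refl rewrite σ-1+p = s≤s z≤n

      involutive : ∀ a → a < N → σ (σ a) ≡ a
      involutive a a<N with region a a<N
      ... | start refl = σ-1+p
      ... | inside 1≤a a<p rewrite σ-spine 1≤a a<p | σ-spine (1≤p∸a a<p) (p∸a<p 1≤a) = m∸[m∸n]≡n (<⇒≤ a<p)
      ... | end refl rewrite σ-p = σ-p
      ... | after refl rewrite σ-1+p = refl

      leaf-p : LeftLeaf p
      leaf-p = ≤-refl , subst (p <_) (+-comm 1 p) (n<1+n p)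
      leaf-1+p : RightLeaf (suc p)
      leaf-1+p = ≤-reflexive (+-comm p 1) , subst (suc p <_) (sym N≡) (n<1+n (suc p))
      1<p : 1 < p
      1<p = s≤s (s≤s z≤n)
      after-leaf : ∀ {t} → RightLeaf t → σ t ≡ 0
      after-leaf leaf = trans (cong σ (trans (unique-rightLeaf refl leaf) (+-comm p 1))) σ-1+p

      old-arc : ∀ {s t} → Arc s t → ¬ PairOf 0 p s t → Adjacent (σ s) (σ t)
      old-arc {zero} (spine refl _) _ rewrite σ-spine ≤-refl 1<p = inj₂ (right refl leaf-1+p)
      old-arc {suc s} (spine refl t<p) _ rewrite σ-spine (s≤s z≤n) (<-trans (n<1+n _) t<p) | σ-spine (s≤s z≤n) t<p =
        inj₂ (spine (∸-suc (<-trans (n<1+n (suc s)) t<p)) (p∸a<p {suc s} (s≤s z≤n)))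
      old-arc (left refl leaf) not-removed = ⊥-elim (not-removed (inj₁ (refl , unique-leftLeaf refl leaf)))
      old-arc (right refl leaf) _ rewrite after-leaf leaf | σ-spine (s≤s z≤n) (n<1+n (suc q)) | m+n∸n≡m 1 (suc q) =
        inj₂ (spine refl 1<p)

      new-edge : Adjacent (σ p) (σ (suc p))
      new-edge rewrite σ-p | σ-1+p = inj₂ (left refl leaf-p)

      arc-back : ∀ {s t} → Arc s t → Reattachedℕ 0 p (suc p) (σ s) (σ t)
      arc-back {zero} (spine refl _) rewrite σ-spine ≤-refl 1<p =
        inj₁ (inj₂ (right refl leaf-1+p) , λ { (inj₁ (() , _)) ; (inj₂ (1+p≡p , _)) → 1+n≢n 1+p≡p })
      arc-back {suc s} (spine refl t<p) rewrite σ-spine (s≤s z≤n) (<-trans (n<1+n _) t<p) | σ-spine (s≤s z≤n) t<p =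
        inj₁ (inj₂ (spine (∸-suc (<-trans (n<1+n (suc s)) t<p)) (p∸a<p {suc s} (s≤s z≤n))) , λ
          { (inj₁ (σs≡0 , _)) → <⇒≱ (1≤p∸a (<-trans (n<1+n (suc s)) t<p)) (≤-reflexive σs≡0)
          ; (inj₂ (σs≡p , _)) → <-irrefl σs≡p (p∸a<p {suc s} (s≤s z≤n)) })
      arc-back (left refl leaf) rewrite unique-leftLeaf refl leaf | σ-p = inj₂ (inj₂ (refl , refl))
      arc-back (right refl leaf) rewrite after-leaf leaf | σ-spine (s≤s z≤n) (n<1+n (suc q)) | m+n∸n≡m 1 (suc q) =
        inj₁ (inj₂ (spine refl 1<p) , λ { (inj₁ (() , _)) ; (inj₂ (1≡p , _)) → <-irrefl 1≡p 1<p })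

    -- The mirror image: moving the leaf p+1 from q+1 to p gives the path p+1, p, 0, 1, …, q+1.
    path-right-to-left : m ≡ 1 → n ≡ 1 → toℕ c ≡ suc q → LeftLeaf (toℕ x) → G″ ≅ G
    path-right-to-left refl refl c≡e x-leaf =
      reattached-≅ c≡e ℓ≡1+p x≡p σ bound involutive old-arc new-edge arc-back
      where
      ℓ≡1+p : toℕ ℓ ≡ suc p
      ℓ≡1+p with arc₁
      ... | rightArc _ leaf = trans (unique-rightLeaf refl leaf) (+-comm p 1)
      ... | leftArc c≡0 _ = case trans (sym c≡e) c≡0 of λ ()
      x≡p : toℕ x ≡ p
      x≡p = unique-leftLeaf refl x-leaf
      N≡ : N ≡ suc (suc p)
      N≡ = trans (+-assoc p 1 1) (+-comm p 2)

      σ : ℕ → ℕ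
      σ a = if a <ᵇ suc q then q ∸ a else if a ≡ᵇ suc q then p else if a ≡ᵇ p then suc q else a

      σ-spine : ∀ {a} → a < suc q → σ a ≡ q ∸ a
      σ-spine a<e rewrite <ᵇ-true a<e = refl
      σ-e : σ (suc q) ≡ p
      σ-e rewrite <ᵇ-false (<-irrefl {suc q} refl) | ≡ᵇ-refl q = refl
      σ-p : σ p ≡ suc q
      σ-p rewrite <ᵇ-false (<-asym (n<1+n (suc q))) | ≡ᵇ-false (1+n≢n {suc q}) | ≡ᵇ-refl q = refl
      σ-1+p : σ (suc p) ≡ suc p
      σ-1+p rewrite <ᵇ-false (<-asym (<-trans (n<1+n (suc q)) (n<1+n p)))
                  | ≡ᵇ-false {suc p} {suc q} (λ 1+p≡e → <-irrefl (sym 1+p≡e) (<-trans (n<1+n (suc q)) (n<1+n p)))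
                  | ≡ᵇ-false (1+n≢n {p}) = refl

      data Region (a : ℕ) : Set where
        inside : a < suc q → Region a
        end    : a ≡ suc q → Region a
        at-p   : a ≡ p → Region a
        after  : a ≡ suc p → Region a

      region : ∀ a → a < N → Region a
      region a a<N with a <? suc q | a ≟ suc q | a ≟ p
      ... | yes a<e | _ | _ = inside a<e
      ... | no _ | yes a≡e | _ = end a≡e
      ... | no _ | no _ | yes a≡p = at-p a≡p
      ... | no a≮e | no a≢e | no a≢p =
        after (≤-antisym (≤-pred (subst (a <_) N≡ a<N)) (≤∧≢⇒< (≤∧≢⇒< (≮⇒≥ a≮e) (a≢e ∘ sym)) (a≢p ∘ sym)))

      q∸a<e : ∀ a → q ∸ a < suc q
      q∸a<e a = s≤s (m∸n≤m q a)
      <N : ∀ {a} → a ≤ suc p → a < N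
      <N {a} a≤1+p = subst (a <_) (sym N≡) (s≤s a≤1+p)

      bound : ∀ a → a < N → σ a < N
      bound a a<N with region a a<N
      ... | inside a<e rewrite σ-spine a<e = <N (≤-trans (≤-trans (m∸n≤m q a) (n≤1+n q)) (≤-trans (n≤1+n (suc q)) (n≤1+n p)))
      ... | end refl rewrite σ-e = <N (n≤1+n p)
      ... | at-p refl rewrite σ-p = <N (≤-trans (n≤1+n (suc q)) (n≤1+n p))
      ... | after refl rewrite σ-1+p = <N ≤-refl

      involutive : ∀ a → a < N → σ (σ a) ≡ a
      involutive a a<N with region a a<N
      ... | inside a<e rewrite σ-spine a<e | σ-spine (q∸a<e a) = m∸[m∸n]≡n (≤-pred a<e)
      ... | end refl rewrite σ-e = σ-p
      ... | at-p refl rewrite σ-p = σ-e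
      ... | after refl rewrite σ-1+p = σ-1+p

      leaf-p : LeftLeaf p
      leaf-p = ≤-refl , subst (p <_) (+-comm 1 p) (n<1+n p)
      leaf-1+p : RightLeaf (suc p)
      leaf-1+p = ≤-reflexive (+-comm p 1) , <N ≤-refl

      old-arc : ∀ {s t} → Arc s t → ¬ PairOf (suc q) (suc p) s t → Adjacent (σ s) (σ t)
      old-arc {s} (spine refl t<p) _ with m≤n⇒m<n∨m≡n (≤-pred t<p)
      ... | inj₁ t<e rewrite σ-spine (<-trans (n<1+n s) t<e) | σ-spine t<e = inj₂ (spine (∸-suc (≤-pred t<e)) (<-trans (q∸a<e s) (n<1+n (suc q))))
      ... | inj₂ refl rewrite σ-spine (n<1+n q) | n∸n≡0 q | σ-e = inj₁ (left refl leaf-p)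
      old-arc (left refl leaf) _ rewrite unique-leftLeaf refl leaf | σ-p = inj₁ (spine refl (n<1+n (suc q)))
      old-arc (right refl leaf) not-removed =
        ⊥-elim (not-removed (inj₁ (refl , trans (unique-rightLeaf refl leaf) (+-comm p 1))))

      new-edge : Adjacent (σ (suc p)) (σ p)
      new-edge rewrite σ-1+p | σ-p = inj₂ (right refl leaf-1+p)

      not-old : ∀ {s t} → s < suc q → ¬ PairOf (suc q) (suc p) s t
      not-old s<e (inj₁ (s≡e , _)) = <-irrefl s≡e s<e
      not-old s<e (inj₂ (s≡1+p , _)) = <-irrefl s≡1+p (<-trans s<e (<-trans (n<1+n (suc q)) (n<1+n p)))

      arc-back : ∀ {s t} → Arc s t → Reattachedℕ (suc q) (suc p) p (σ s) (σ t)
      arc-back {s} (spine refl t<p) with m≤n⇒m<n∨m≡n (≤-pred t<p)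
      ... | inj₁ t<e rewrite σ-spine (<-trans (n<1+n s) t<e) | σ-spine t<e =
        inj₁ (inj₂ (spine (∸-suc (≤-pred t<e)) (<-trans (q∸a<e s) (n<1+n (suc q)))) , not-old (q∸a<e s))
      ... | inj₂ refl rewrite σ-spine (n<1+n q) | n∸n≡0 q | σ-e = inj₁ (inj₁ (left refl leaf-p) , not-old (s≤s z≤n))
      arc-back (left refl leaf) rewrite unique-leftLeaf refl leaf | σ-p = inj₁ (inj₁ (spine refl (n<1+n (suc q))) , not-old (n<1+n q))
      arc-back (right refl leaf) rewrite trans (unique-rightLeaf refl leaf) (+-comm p 1) | σ-e | σ-1+p = inj₂ (inj₂ (refl , refl))

    -- When n = m + 1 and a right leaf L moves to 0, the two centres swap roles: σ reflects the spine, fixes L,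
    -- and exchanges the m left leaves with the m right leaves other than L, in order.
    right-to-leftEnd : n ≡ suc m → toℕ c ≡ suc q → toℕ x ≡ 0 → G″ ≅ G
    right-to-leftEnd refl c≡e x≡0 = reattached-≅ c≡e refl x≡0 σ bound involutive old-arc new-edge arc-back
      where
      L = toℕ ℓ
      L-leaf : RightLeaf L
      L-leaf with arc₁
      ... | rightArc _ leaf = leaf
      ... | leftArc c≡0 _ = case trans (sym c≡e) c≡0 of λ ()
      p+m≤L = proj₁ L-leaf
      L<N = proj₂ L-leaf
      N≡ : N ≡ suc (p + m + m)
      N≡ = +-suc (p + m) m
      L≤p+m+m : L ≤ p + m + m
      L≤p+m+m = ≤-pred (subst (L <_) N≡ L<N)
      p≤L = ≤-trans p≤p+m p+m≤L

      σ : ℕ → ℕ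
      σ a = if a <ᵇ p then suc q ∸ a
            else if a <ᵇ p + m then (if a + m <ᵇ L then a + m else suc (a + m))
            else if a <ᵇ L then a ∸ m
            else if a ≡ᵇ L then L else a ∸ suc m

      data Region (a : ℕ) : Set where
        onSpine    : a < p → Region a
        leftBelow  : ¬ a < p → a < p + m → a + m < L → Region a
        leftAbove  : ¬ a < p → a < p + m → ¬ a + m < L → Region a
        rightBelow : ¬ a < p → ¬ a < p + m → a < L → Region a
        atL        : a ≡ L → Region a
        rightAbove : ¬ a < p → ¬ a < p + m → ¬ a < L → ¬ a ≡ L → Region a

      region : ∀ a → Region a
      region a with a <? p | a <? p + m | a + m <? L | a <? L | a ≟ L
      ... | yes a<p | _ | _ | _ | _ = onSpine a<p
      ... | no a≮p | yes a<p+m | yes below | _ | _ = leftBelow a≮p a<p+m below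
      ... | no a≮p | yes a<p+m | no above | _ | _ = leftAbove a≮p a<p+m above
      ... | no a≮p | no a≮p+m | _ | yes a<L | _ = rightBelow a≮p a≮p+m a<L
      ... | no _ | no _ | _ | no _ | yes a≡L = atL a≡L
      ... | no a≮p | no a≮p+m | _ | no a≮L | no a≢L = rightAbove a≮p a≮p+m a≮L a≢L

      σ-spine : ∀ {a} → a < p → σ a ≡ suc q ∸ a
      σ-spine a<p rewrite <ᵇ-true a<p = refl
      σ-leftBelow : ∀ {a} → ¬ a < p → a < p + m → a + m < L → σ a ≡ a + m
      σ-leftBelow a≮p a<p+m below rewrite <ᵇ-false a≮p | <ᵇ-true a<p+m | <ᵇ-true below = refl
      σ-leftAbove : ∀ {a} → ¬ a < p → a < p + m → ¬ a + m < L → σ a ≡ suc (a + m)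
      σ-leftAbove a≮p a<p+m above rewrite <ᵇ-false a≮p | <ᵇ-true a<p+m | <ᵇ-false above = refl
      σ-rightBelow : ∀ {a} → ¬ a < p → ¬ a < p + m → a < L → σ a ≡ a ∸ m
      σ-rightBelow a≮p a≮p+m a<L rewrite <ᵇ-false a≮p | <ᵇ-false a≮p+m | <ᵇ-true a<L = refl
      σ-L : σ L ≡ L
      σ-L rewrite <ᵇ-false (≤⇒≯ p≤L) | <ᵇ-false (≤⇒≯ p+m≤L) | <ᵇ-false (<-irrefl {L} refl) | ≡ᵇ-refl L = refl
      σ-rightAbove : ∀ {a} → ¬ a < p → ¬ a < p + m → ¬ a < L → ¬ a ≡ L → σ a ≡ a ∸ suc m
      σ-rightAbove a≮p a≮p+m a≮L a≢L rewrite <ᵇ-false a≮p | <ᵇ-false a≮p+m | <ᵇ-false a≮L | ≡ᵇ-false a≢L = refl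

      L<a⇒ : ∀ {a} → L < a → p + suc m ≤ a
      L<a⇒ {a} L<a = subst (_≤ a) (sym (+-suc p m)) (≤-trans (s≤s p+m≤L) L<a)

      bound : ∀ a → a < N → σ a < N
      bound a a<N with region a
      ... | onSpine a<p rewrite σ-spine a<p = ≤-<-trans (m∸n≤m (suc q) a) (<-≤-trans (n<1+n (suc q)) (≤-trans p≤p+m p+m≤N))
      ... | leftBelow a≮p a<p+m below rewrite σ-leftBelow a≮p a<p+m below = <-trans below L<N
      ... | leftAbove a≮p a<p+m above rewrite σ-leftAbove a≮p a<p+m above = subst (suc (a + m) <_) (sym N≡) (s≤s (+-monoˡ-< m a<p+m))
      ... | rightBelow a≮p a≮p+m a<L rewrite σ-rightBelow a≮p a≮p+m a<L = ≤-<-trans (m∸n≤m a m) a<N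
      ... | atL refl rewrite σ-L = L<N
      ... | rightAbove a≮p a≮p+m a≮L a≢L rewrite σ-rightAbove a≮p a≮p+m a≮L a≢L = ≤-<-trans (m∸n≤m a (suc m)) a<N

      involutive : ∀ a → a < N → σ (σ a) ≡ a
      involutive a a<N with region a
      ... | onSpine a<p rewrite σ-spine a<p | σ-spine (s≤s (m∸n≤m (suc q) a)) = m∸[m∸n]≡n (≤-pred a<p)
      ... | leftBelow a≮p a<p+m below rewrite σ-leftBelow a≮p a<p+m below =
        trans (σ-rightBelow (λ a+m<p → a≮p (≤-<-trans (m≤m+n a m) a+m<p)) (λ a+m<p+m → a≮p (+-cancelʳ-< m a p a+m<p+m)) below)
              (m+n∸n≡m a m)
      ... | leftAbove a≮p a<p+m above rewrite σ-leftAbove a≮p a<p+m above =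
        trans (σ-rightAbove (λ 1+a+m<p → <⇒≱ 1+a+m<p (≤-trans p≤L L≤1+a+m))
                            (λ 1+a+m<p+m → <⇒≱ 1+a+m<p+m (≤-trans p+m≤L L≤1+a+m))
                            (λ 1+a+m<L → <⇒≱ 1+a+m<L L≤1+a+m)
                            (λ 1+a+m≡L → <-irrefl (sym 1+a+m≡L) (s≤s (≮⇒≥ above))))
              (m+n∸n≡m a m)
        where L≤1+a+m = ≤-trans (≮⇒≥ above) (n≤1+n _)
      ... | rightBelow a≮p a≮p+m a<L rewrite σ-rightBelow a≮p a≮p+m a<L =
        trans (σ-leftBelow (λ a∸m<p → <⇒≱ a∸m<p (m+n≤o⇒m≤o∸n p p+m≤a)) a∸m<p+m (subst (_< L) (sym a∸m+m≡a) a<L)) a∸m+m≡a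
        where
        p+m≤a = ≮⇒≥ a≮p+m
        a∸m+m≡a = m∸n+n≡m (≤-trans (m≤n+m m p) p+m≤a)
        a∸m<p+m : a ∸ m < p + m
        a∸m<p+m = +-cancelʳ-< m (a ∸ m) (p + m) (subst (_< p + m + m) (sym a∸m+m≡a) (<-≤-trans a<L L≤p+m+m))
      ... | atL refl rewrite σ-L = σ-L
      ... | rightAbove a≮p a≮p+m a≮L a≢L rewrite σ-rightAbove a≮p a≮p+m a≮L a≢L =
        trans (σ-leftAbove a′≮p a′<p+m a′+m≮L) 1+a′+m≡a
        where
        L<a = ≤∧≢⇒< (≮⇒≥ a≮L) (a≢L ∘ sym)
        a′ = a ∸ suc m
        a′+1+m≡a : a′ + suc m ≡ a
        a′+1+m≡a = m∸n+n≡m (≤-trans (m≤n+m (suc m) p) (L<a⇒ L<a))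
        1+a′+m≡a : suc (a′ + m) ≡ a
        1+a′+m≡a = trans (sym (+-suc a′ m)) a′+1+m≡a
        a′≮p : ¬ a′ < p
        a′≮p a′<p = <⇒≱ a′<p (m+n≤o⇒m≤o∸n p (L<a⇒ L<a))
        a′<p+m : a′ < p + m
        a′<p+m = +-cancelʳ-< (suc m) a′ (p + m) (subst (_< p + m + suc m) (sym a′+1+m≡a) a<N)
        a′+m≮L : ¬ a′ + m < L
        a′+m≮L a′+m<L = <⇒≱ L<a (subst (_≤ L) 1+a′+m≡a a′+m<L)

      left↦right : ∀ {y} → LeftLeaf y → RightLeaf (σ y) × ¬ σ y ≡ L
      left↦right {y} (p≤y , y<p+m) with y + m <? L
      ... | yes below rewrite σ-leftBelow (≤⇒≯ p≤y) y<p+m below =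
        (+-monoˡ-≤ m p≤y , <-trans below L<N) , λ y+m≡L → <-irrefl y+m≡L below
      ... | no above rewrite σ-leftAbove (≤⇒≯ p≤y) y<p+m above =
        (≤-trans (+-monoˡ-≤ m p≤y) (n≤1+n _) , subst (suc (y + m) <_) (sym N≡) (s≤s (+-monoˡ-< m y<p+m))) ,
        λ 1+y+m≡L → <-irrefl (sym 1+y+m≡L) (s≤s (≮⇒≥ above))

      right↦left : ∀ {y} → RightLeaf y → ¬ y ≡ L → LeftLeaf (σ y)
      right↦left {y} (p+m≤y , y<N) y≢L with y <? L
      ... | yes y<L rewrite σ-rightBelow (≤⇒≯ (≤-trans p≤p+m p+m≤y)) (≤⇒≯ p+m≤y) y<L =
        m+n≤o⇒m≤o∸n p p+m≤y , +-cancelʳ-< m (y ∸ m) (p + m) (subst (_< p + m + m) (sym y∸m+m≡y) (<-≤-trans y<L L≤p+m+m))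
        where y∸m+m≡y = m∸n+n≡m (≤-trans (m≤n+m m p) p+m≤y)
      ... | no y≮L rewrite σ-rightAbove (≤⇒≯ (≤-trans p≤p+m p+m≤y)) (≤⇒≯ p+m≤y) y≮L y≢L =
        m+n≤o⇒m≤o∸n p (L<a⇒ L<y) ,
        +-cancelʳ-< (suc m) (y ∸ suc m) (p + m) (subst (_< p + m + suc m) (sym (m∸n+n≡m (≤-trans (m≤n+m (suc m) p) (L<a⇒ L<y)))) y<N)
        where L<y = ≤∧≢⇒< (≮⇒≥ y≮L) (y≢L ∘ sym)

      spine↦spine : ∀ {s} → suc s < p → Arc (σ (suc s)) (σ s)
      spine↦spine {s} 1+s<p rewrite σ-spine (<-trans (n<1+n s) 1+s<p) | σ-spine 1+s<p =
        spine (∸-suc (≤-pred 1+s<p)) (s≤s (m∸n≤m (suc q) s))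

      spine-not-removed : ∀ {s t} → s < p → t < p → ¬ PairOf (suc q) L s t
      spine-not-removed _ t<p (inj₁ (_ , t≡L)) = <⇒≱ t<p (subst (p ≤_) (sym t≡L) p≤L)
      spine-not-removed s<p _ (inj₂ (s≡L , _)) = <⇒≱ s<p (subst (p ≤_) (sym s≡L) p≤L)

      old-arc : ∀ {s t} → Arc s t → ¬ PairOf (suc q) L s t → Adjacent (σ s) (σ t)
      old-arc (spine refl t<p) _ = inj₂ (spine↦spine t<p)
      old-arc (left refl leaf) _ = inj₁ (right refl (proj₁ (left↦right leaf)))
      old-arc {t = t} (right refl leaf) not-removed rewrite σ-spine (n<1+n (suc q)) | n∸n≡0 (suc q) =
        inj₁ (left refl (right↦left leaf (λ t≡L → not-removed (inj₁ (refl , t≡L)))))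

      new-edge : Adjacent (σ L) (σ 0)
      new-edge rewrite σ-L = inj₂ (right refl L-leaf)

      arc-back : ∀ {s t} → Arc s t → Reattachedℕ (suc q) L 0 (σ s) (σ t)
      arc-back {s} (spine refl t<p) =
        inj₁ (inj₂ (spine↦spine t<p) , spine-not-removed (σ<p s (<-trans (n<1+n s) t<p)) (σ<p (suc s) t<p))
        where
        σ<p : ∀ a → a < p → σ a < p
        σ<p a a<p rewrite σ-spine a<p = s≤s (m∸n≤m (suc q) a)
      arc-back (left refl leaf) =
        inj₁ (inj₁ (right refl (proj₁ (left↦right leaf))) , λ
          { (inj₁ (_ , σt≡L)) → proj₂ (left↦right leaf) σt≡L
          ; (inj₂ (e≡L , _)) → <⇒≱ (n<1+n (suc q)) (subst (p ≤_) (sym e≡L) p≤L) })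
      arc-back {t = t} (right refl leaf) rewrite σ-spine (n<1+n (suc q)) | n∸n≡0 (suc q) with t ≟ L
      ... | yes refl rewrite σ-L = inj₂ (inj₂ (refl , refl))
      ... | no t≢L = inj₁ (inj₁ (left refl (right↦left leaf t≢L)) , λ
          { (inj₁ ()) ; (inj₂ (0≡L , _)) → <⇒≱ (s≤s z≤n) (subst (p ≤_) (sym 0≡L) p≤L) })

    moved-from-left : m ≤ n → ¬ (m ≡ 2 × 5 ≤ p) → ¬ (m ≡ 1 × 2 ≤ n × 4 ≤ p) →
                      ¬ x ≡ c → toℕ c ≡ 0 → Position (toℕ x) → G″ ≅ G
    moved-from-left m≤n ¬long₂ ¬long₁ x≢c c≡0 pos = go pos
      where
      deg-x : deg (toℕ x) ≡ m
      deg-x = suc-injective (trans (deg-target x≢c) (trans (cong deg c≡0) deg-leftEnd))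
      go : Position (toℕ x) → G″ ≅ G
      go (leftEnd x≡0) = ⊥-elim (x≢c (toℕ-injective (trans x≡0 (sym c≡0))))
      go (rightEnd x≡e) = ⊥-elim (<⇒≱ (s≤s m≤n) (≤-reflexive (trans (sym deg-rightEnd) (trans (cong deg (sym x≡e)) deg-x))))
      go (leftLeaf leaf) with arc₁
      ... | leftArc _ ℓ-leaf = ⊥-elim (leaf≢x (toℕ-injective (trans (unique-leftLeaf m≡1 ℓ-leaf) (sym (unique-leftLeaf m≡1 leaf)))))
        where m≡1 = trans (sym deg-x) (deg-leftLeaf leaf)
      ... | rightArc c≡e _ = case trans (sym c≡0) c≡e of λ ()
      go (interior i x≡1+i i<q) = ⊥-elim (left-to-inner m≡2 q≡2 2≤n x≢c c≡0 i x≡1+i (subst (i <_) q≡2 i<q))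
        where
        m≡2 : m ≡ 2
        m≡2 = trans (sym deg-x) (trans (cong deg x≡1+i) (deg-interior i<q))
        2≤n : 2 ≤ n
        2≤n = subst (_≤ n) m≡2 m≤n
        q≡2 : q ≡ 2
        q≡2 = ≤-antisym (≤-pred (≤-pred (≮⇒≥ (λ 5≤p → ¬long₂ (m≡2 , 5≤p)))))
                        (middle-needs-spine (≤-reflexive (sym m≡2)) 2≤n arc₂)
      go (rightLeaf leaf) with n ≟ 1
      ... | yes n≡1 = path-left-to-right m≡1 n≡1 c≡0 leaf
        where m≡1 = trans (sym deg-x) (deg-rightLeaf leaf)
      ... | no n≢1 = ⊥-elim (left-to-rightLeaf m≡1 q≡1 2≤n x≢c c≡0 leaf)
        where
        m≡1 : m ≡ 1
        m≡1 = trans (sym deg-x) (deg-rightLeaf leaf)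
        2≤n : 2 ≤ n
        2≤n = ≤∧≢⇒< 1≤n (n≢1 ∘ sym)
        q≡1 : q ≡ 1
        q≡1 = ≤-antisym (≤-pred (≤-pred (≮⇒≥ (λ 4≤p → ¬long₁ (m≡1 , 2≤n , 4≤p))))) (middle-needs-interior 2≤n arc₂)

    moved-from-right : m ≤ n → ¬ (m ≡ 2 × 5 ≤ p) → ¬ (m ≡ 1 × 2 ≤ n × 4 ≤ p) →
                       ¬ x ≡ c → toℕ c ≡ suc q → Position (toℕ x) → G″ ≅ G
    moved-from-right m≤n ¬long₂ ¬long₁ x≢c c≡e pos = go pos
      where
      deg-x : deg (toℕ x) ≡ n
      deg-x = suc-injective (trans (deg-target x≢c) (trans (cong deg c≡e) deg-rightEnd))
      go : Position (toℕ x) → G″ ≅ G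
      go (rightEnd x≡e) = ⊥-elim (x≢c (toℕ-injective (trans x≡e (sym c≡e))))
      go (rightLeaf leaf) with arc₁
      ... | rightArc _ ℓ-leaf = ⊥-elim (leaf≢x (toℕ-injective (trans (unique-rightLeaf n≡1 ℓ-leaf) (sym (unique-rightLeaf n≡1 leaf)))))
        where n≡1 = trans (sym deg-x) (deg-rightLeaf leaf)
      ... | leftArc c≡0 _ = case trans (sym c≡e) c≡0 of λ ()
      go (leftEnd x≡0) = right-to-leftEnd (trans (sym deg-x) (trans (cong deg x≡0) deg-leftEnd)) c≡e x≡0
      go (leftLeaf leaf) = path-right-to-left m≡1 n≡1 c≡e leaf
        where
        n≡1 : n ≡ 1
        n≡1 = trans (sym deg-x) (deg-leftLeaf leaf)
        m≡1 : m ≡ 1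
        m≡1 = ≤-antisym (subst (m ≤_) n≡1 m≤n) 1≤m
      go (interior i x≡1+i i<q) with m ≟ 1
      ... | yes m≡1 = ⊥-elim (right-to-inner₁ m≡1 n≡2 q≡1 x≢c (trans c≡e (cong suc q≡1)) x≡1)
        where
        n≡2 : n ≡ 2
        n≡2 = trans (sym deg-x) (trans (cong deg x≡1+i) (deg-interior i<q))
        q≡1 : q ≡ 1
        q≡1 = ≤-antisym (≤-pred (≤-pred (≮⇒≥ (λ 4≤p → ¬long₁ (m≡1 , ≤-reflexive (sym n≡2) , 4≤p))))) (≤-trans (s≤s z≤n) i<q)
        x≡1 : toℕ x ≡ 1
        x≡1 = trans x≡1+i (cong suc (n<1⇒n≡0 (subst (i <_) q≡1 i<q)))
      ... | no m≢1 = ⊥-elim (right-to-inner m≡2 n≡2 q≡2 x≢c (trans c≡e (cong suc q≡2)) i x≡1+i (subst (i <_) q≡2 i<q))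
        where
        n≡2 : n ≡ 2
        n≡2 = trans (sym deg-x) (trans (cong deg x≡1+i) (deg-interior i<q))
        m≡2 : m ≡ 2
        m≡2 = ≤-antisym (subst (m ≤_) n≡2 m≤n) (≤∧≢⇒< 1≤m (m≢1 ∘ sym))
        q≡2 : q ≡ 2
        q≡2 = ≤-antisym (≤-pred (≤-pred (≮⇒≥ (λ 5≤p → ¬long₂ (m≡2 , 5≤p)))))
                        (middle-needs-spine (≤-reflexive (sym m≡2)) (≤-reflexive (sym n≡2)) arc₂)

    reattached≅broom : m ≤ n → ¬ (m ≡ 2 × 5 ≤ p) → ¬ (m ≡ 1 × 2 ≤ n × 4 ≤ p) → G″ ≅ G
    reattached≅broom m≤n ¬long₂ ¬long₁ with x ≟ᶠ c | arc₁
    ... | yes x≡c | _ = subst (λ z → reattachLeaf G e₁ z ≅ G) (sym x≡c) (reattachLeaf-origin G simple e₁)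
    ... | no x≢c | leftArc c≡0 _ = moved-from-left m≤n ¬long₂ ¬long₁ x≢c c≡0 (position (toℕ x) (toℕ<n x))
    ... | no x≢c | rightArc c≡e _ = moved-from-right m≤n ¬long₂ ¬long₁ x≢c c≡e (position (toℕ x) (toℕ<n x))

lemma6 : (m n p : ℕ) → 1 ≤ m → m ≤ n → 2 ≤ p →
         ¬ (m ≡ 2 × 5 ≤ p) →
         ¬ (m ≡ 1 × 2 ≤ n × 4 ≤ p) →
         (e₁ e₂ : Edge (DoubleBroom m n p)) →
         LeafEdge (DoubleBroom m n p) e₁ →
         MiddleEdge (DoubleBroom m n p) e₂ →
         Determines (DoubleBroom m n p)
           (decard (DoubleBroom m n p) e₁ ∷ decard (DoubleBroom m n p) e₂ ∷ [])
lemma6 m n (suc (suc q)) 1≤m m≤n (s≤s (s≤s z≤n)) ¬long₂ ¬long₁ e₁ e₂ leafEdge middleEdge H simpleH (f , _ , decards) =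
  ≅-trans {H} {reattachLeaf G e₁ x} {G} H≅G″ (Reattached.reattached≅broom leafEdge middleEdge r m≤n ¬long₂ ¬long₁)
  where
  open BroomGraph m n q 1≤m (≤-trans 1≤m m≤n)
  reconstruction : Σ (LeafReattachment G e₁ e₂) λ r → H ≅ reattachLeaf G e₁ (LeafReattachment.x r)
  reconstruction =
    reattachment simple simpleH {e₁} {e₂} (leafEdge-leaf e₁ leafEdge) (proj₁ middleEdge) (deleteMiddle-no-isolated e₂ middleEdge)
      {f zero} {f (suc zero)} (proj₁ (decards zero)) (proj₂ (decards zero)) (proj₁ (decards (suc zero))) (proj₂ (decards (suc zero)))
  r : LeafReattachment G e₁ e₂
  r = proj₁ reconstruction
  x : Fin N
  x = LeafReattachment.x r
  H≅G″ : H ≅ reattachLeaf G e₁ x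
  H≅G″ = proj₂ reconstruction
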